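{- Let $n>3$, let $P,Q$ be finite posets with $|P|=p$, $|Q|=q$, let $D_\lambda\in\mathfrak{D}_n$, and $R=P\oplus D_\lambda\oplus Q$. Suppose $p=q+n-4$. Then the statement "for every linear extension $f$ of $R$ and all integers $1\le i$, $i+1<j<k\le p+n+q$, $(t_iq_{jk})^2(f)$ agrees with $f$ on $D_\lambda$" holds if and only if $q\bmod n\notin\{1,3\}$.
   Context: For a finite poset $X$ with $|X|=N$, a linear extension is a bijection $f:X\to\{1,\ldots,N\}$ with $f(a)<f(b)$ whenever $a<_X b$. For $1\le i\le N-1$ the Bender–Knuth involution $t_i$ swaps labels $i$ and $i+1$ if $f^{ -1}(i)$, $f^{ -1}(i+1)$ are incomparable, and does nothing otherwise. Products denote composition, rightmost first. $q_0=\mathrm{id}$, $q_i=t_1(t_2t_1)\cdots(t_it_{i-1}\cdots t_1)$, $q_{jk}=q_{k-1}q_{k-j}q_{k-1}$. $X\oplus Y$: ordinal sum (all of $X$ below all of $Y$); $+$: disjoint union; $C_m$: $m$-element chain. For $n>1$, $\mathfrak{D}_n$ is the set of posets $C_{\lambda_1}+\cdots+C_{\lambda_\ell}$ with $\lambda\vdash n$, $\ell>1$ (at least two chains). Convention: $a\bmod n$ denotes the representative in $\{1,\ldots,n\}$. -}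

module Defs where

open import Data.Nat using (ℕ; zero; suc; _+_; _≤_; _<_; _≟_; _%_; NonZero)
open import Data.Nat.Properties using (_≤?_)
open import Data.Fin using (Fin; toℕ; splitAt; _↑ˡ_; _↑ʳ_)
open import Data.Fin.Properties using (all?)
open import Data.Sum using (_⊎_; inj₁; inj₂)
open import Data.Product using (_×_; _,_; ∃)
open import Data.Empty using (⊥)
open import Data.Unit using (⊤; tt)
open import Data.Bool using (if_then_else_)
open import Data.List using (List; []; _∷_; length)
open import Data.Nat.ListAction using (sum)
open import Data.List.Relation.Unary.All using (All)
open import Data.List.Relation.Unary.Linked using (Linked)
open import Relation.Nullary using (¬_; Dec; yes; no; does)
open import Relation.Nullary.Decidable using (_×-dec_; _→-dec_; ¬?)
open import Relation.Binary using (Decidable; IsDecPartialOrder)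
open import Relation.Binary.PropositionalEquality using (_≡_; _≢_)
open import Function using (_∘_; id)

record FinPoset (p : ℕ) : Set₁ where
  field
    _≼_ : Fin p → Fin p → Set
    isDecPartialOrder : IsDecPartialOrder _≡_ _≼_
  open IsDecPartialOrder isDecPartialOrder public
    using () renaming (_≤?_ to _≼?_)

ordSum : ∀ a {b} → (Fin a → Fin a → Set) → (Fin b → Fin b → Set)
       → Fin (a + b) → Fin (a + b) → Set
ordSum a R S x y with splitAt a x | splitAt a y
... | inj₁ u | inj₁ v = R u v
... | inj₁ u | inj₂ v = ⊤
... | inj₂ u | inj₁ v = ⊥
... | inj₂ u | inj₂ v = S u v

ordSum? : ∀ a {b} {R : Fin a → Fin a → Set} {S : Fin b → Fin b → Set}
        → Decidable R → Decidable S → Decidable (ordSum a R S)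
ordSum? a R? S? x y with splitAt a x | splitAt a y
... | inj₁ u | inj₁ v = R? u v
... | inj₁ u | inj₂ v = yes tt
... | inj₂ u | inj₁ v = no (λ ())
... | inj₂ u | inj₂ v = S? u v

-- D_λ = C_{λ₁} + ... + C_{λ_ℓ}: disjoint union of chains, carrier Fin (sum λ);
-- the first λ₁ elements form the chain C_{λ₁} (ordered as in Fin), etc.

chainsLE : (λs : List ℕ) → Fin (sum λs) → Fin (sum λs) → Set
chainsLE [] () y
chainsLE (m ∷ λs) x y with splitAt m x | splitAt m y
... | inj₁ u | inj₁ v = toℕ u ≤ toℕ v
... | inj₁ u | inj₂ v = ⊥
... | inj₂ u | inj₁ v = ⊥
... | inj₂ u | inj₂ v = chainsLE λs u v

chainsLE? : (λs : List ℕ) → Decidable (chainsLE λs)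
chainsLE? [] () y
chainsLE? (m ∷ λs) x y with splitAt m x | splitAt m y
... | inj₁ u | inj₁ v = toℕ u ≤? toℕ v
... | inj₁ u | inj₂ v = no (λ ())
... | inj₂ u | inj₁ v = no (λ ())
... | inj₂ u | inj₂ v = chainsLE? λs u v

-- λ ⊢ n with at least two parts (so D_λ ∈ 𝔇_n).
record IsPartitionD (n : ℕ) (λs : List ℕ) : Set where
  field
    parts-pos  : All (λ m → 0 < m) λs
    decreasing : Linked (λ a b → b ≤ a) λs
    sums-to    : sum λs ≡ n
    two-parts  : 1 < length λs

RLE : ∀ {p q} → FinPoset p → (λs : List ℕ) → FinPoset q
    → Fin (p + (sum λs + q)) → Fin (p + (sum λs + q)) → Set
RLE {p} {q} P λs Q =
  ordSum p (FinPoset._≼_ P) (ordSum (sum λs) (chainsLE λs) (FinPoset._≼_ Q))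

RLE? : ∀ {p q} (P : FinPoset p) (λs : List ℕ) (Q : FinPoset q)
     → Decidable (RLE P λs Q)
RLE? {p} {q} P λs Q =
  ordSum? p (FinPoset._≼?_ P) (ordSum? (sum λs) (chainsLE? λs) (FinPoset._≼?_ Q))

inD : ∀ p {s} q → Fin s → Fin (p + (s + q))
inD p q d = p ↑ʳ (d ↑ˡ q)

record IsLinearExtension {N : ℕ} (_≼_ : Fin N → Fin N → Set) (f : Fin N → ℕ) : Set where
  field
    injective : ∀ x y → f x ≡ f y → x ≡ y
    in-range  : ∀ x → 1 ≤ f x × f x ≤ N
    surjective : ∀ l → 1 ≤ l → l ≤ N → ∃ λ x → f x ≡ l
    monotone  : ∀ a b → a ≼ b → a ≢ b → f a < f b

Incomparable : ∀ {N} → (Fin N → Fin N → Set) → Fin N → Fin N → Set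
Incomparable _≼_ x y = ¬ (x ≼ y) × ¬ (y ≼ x)

-- Bender–Knuth involution t_i: swaps labels i and i+1 iff the elements
-- f⁻¹(i), f⁻¹(i+1) are incomparable.
BK : ∀ {N} (_≼_ : Fin N → Fin N → Set) → Decidable _≼_
   → ℕ → (Fin N → ℕ) → (Fin N → ℕ)
BK _≼_ _≼?_ i f x with f x ≟ i
... | yes _ = if does (all? (λ y → (f y ≟ suc i) →-dec inc? x y)) then suc i else i
  where inc? : ∀ x y → Dec (Incomparable _≼_ x y)
        inc? x y = ¬? (x ≼? y) ×-dec ¬? (y ≼? x)
... | no _ with f x ≟ suc i
...   | yes _ = if does (all? (λ y → (f y ≟ i) →-dec inc? x y)) then i else f x
  where inc? : ∀ x y → Dec (Incomparable _≼_ x y)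
        inc? x y = ¬? (x ≼? y) ×-dec ¬? (y ≼? x)
...   | no _ = f x

module BKOps {N : ℕ} (_≼_ : Fin N → Fin N → Set) (_≼?_ : Decidable _≼_) where
  t : ℕ → (Fin N → ℕ) → (Fin N → ℕ)
  t = BK _≼_ _≼?_

  down : ℕ → (Fin N → ℕ) → (Fin N → ℕ)
  down zero = id
  down (suc i) = t (suc i) ∘ down i

  -- q_0 = id, q_i = t_1 (t_2 t_1) ⋯ (t_i ⋯ t_1) = q_{i-1} ∘ (t_i ⋯ t_1)
  qq : ℕ → (Fin N → ℕ) → (Fin N → ℕ)
  qq zero = id
  qq (suc i) = qq i ∘ down (suc i)

  qjk : ℕ → ℕ → (Fin N → ℕ) → (Fin N → ℕ)
  qjk j k = qq (k Data.Nat.∸ 1) ∘ qq (k Data.Nat.∸ j) ∘ qq (k Data.Nat.∸ 1)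

  sq : ℕ → ℕ → ℕ → (Fin N → ℕ) → (Fin N → ℕ)
  sq i j k = (t i ∘ qjk j k) ∘ (t i ∘ qjk j k)

Property : ∀ {p q} → FinPoset p → (λs : List ℕ) → FinPoset q → Set
Property {p} {q} P λs Q =
  ∀ (f : Fin (p + (sum λs + q)) → ℕ) → IsLinearExtension (RLE P λs Q) f →
  ∀ (i j k : ℕ) → 1 ≤ i → suc i < j → j < k → k ≤ p + (sum λs + q) →
  ∀ (d : Fin (sum λs)) →
    BKOps.sq (RLE P λs Q) (RLE? P λs Q) i j k f (inD p q d) ≡ f (inD p q d)

-- a mod n with representative in {1,…,n}
-- (n = 0 never occurs in the lemma, since n > 3; the value there is a dummy)
modRep : ℕ → ℕ → ℕ
modRep a zero = zero
modRep a (suc m) with a % suc m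
... | zero = suc m
... | suc r = suc r

-- On every linear extension of R = P ⊕ D_λ ⊕ Q the labels of D_λ are p + 1 … p + n, and a linear extension
-- is determined on D_λ by its column word: which chain carries the label p + l, for l = 1 … n.  A
-- Bender–Knuth move t_r acts on column words by a fixed permutation σ_r of positions (the transposition
-- of r - p and r - p + 1, or the identity) whether or not it really swaps two labels, because labels it
-- refuses to swap are comparable, i.e. lie in one chain.  Hence (t_i q_{jk})² fixes D_λ as soon as the
-- induced position permutation is the identity.  Computing it (q_a becomes a prefix reversal followed by
-- rotations; p = q + n - 4 pins down the one tight case) shows that it is, except when i = p + 1,
-- j = p + 3, k = N and q mod n ∈ {1, 3}; there it moves position 2 resp. 1, and applying it to an
-- extension whose column word starts 1 0 changes a label.

module Submission where

open import Defs
open import Data.Nat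
open import Data.Nat.Properties
open import Data.Nat.DivMod using (%-distribˡ-+; m<n⇒m%n≡m; n%n≡0; m%n<n)
open import Data.Nat.GeneralisedArithmetic using (fold)
open import Data.Nat.Induction using (<-rec)
open import Data.Nat.ListAction using (sum)
open import Data.Nat.Tactic.RingSolver using (solve-∀)
open import Data.Fin as F using (Fin; toℕ; splitAt; _↑ˡ_; _↑ʳ_; fromℕ<)
open import Data.Fin.Properties as FP
  using (all?; splitAt-↑ˡ; splitAt-↑ʳ; splitAt⁻¹-↑ˡ; splitAt⁻¹-↑ʳ; toℕ-↑ˡ; toℕ-↑ʳ;
         ↑ˡ-injective; ↑ʳ-injective; toℕ-injective; toℕ<n; toℕ-fromℕ<)
open import Data.Product using (_×_; _,_; proj₁; proj₂; ∃; Σ)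
open import Data.Sum using (_⊎_; inj₁; inj₂; [_,_]′)
open import Data.Empty using (⊥-elim)
open import Data.Unit using (tt)
open import Data.Bool using (Bool; true; false; if_then_else_)
open import Data.List using (List; []; _∷_; length)
open import Data.List.Relation.Unary.All using (All; _∷_)
open import Relation.Nullary using (¬_; Dec; yes; no; does)
open import Relation.Nullary.Decidable using (_×-dec_; _⊎-dec_; _→-dec_; ¬?)
open import Relation.Binary using (Decidable; IsDecPartialOrder; tri<; tri≈; tri>)
open import Relation.Binary.PropositionalEquality
  using (_≡_; _≢_; refl; sym; trans; cong; cong₂; subst; subst₂; _≗_; module ≡-Reasoning)
open import Function using (_∘_; id)
open import Function.Bundles using (_⇔_; mk⇔)

InRange : ℕ → ℕ → Set
InRange N l = 1 ≤ l × l ≤ N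

swap : ℕ → ℕ → ℕ
swap r l with l ≟ r
... | yes _ = suc r
... | no _ with l ≟ suc r
...   | yes _ = r
...   | no _ = l

data SwapView (r l : ℕ) : Set where
  at-r      : l ≡ r → SwapView r l
  at-suc-r  : l ≡ suc r → SwapView r l
  elsewhere : l ≢ r → l ≢ suc r → SwapView r l

swap-view : ∀ r l → SwapView r l
swap-view r l with l ≟ r
... | yes e = at-r e
... | no a with l ≟ suc r
...   | yes e = at-suc-r e
...   | no b = elsewhere a b

swap-r : ∀ r → swap r r ≡ suc r
swap-r r with r ≟ r
... | yes _ = refl
... | no ne = ⊥-elim (ne refl)

swap-suc-r : ∀ r → swap r (suc r) ≡ r
swap-suc-r r with suc r ≟ r
... | yes e = ⊥-elim (1+n≢n e)
... | no _ with suc r ≟ suc r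
...   | yes _ = refl
...   | no ne = ⊥-elim (ne refl)

swap-other : ∀ r l → l ≢ r → l ≢ suc r → swap r l ≡ l
swap-other r l a b with l ≟ r
... | yes e = ⊥-elim (a e)
... | no _ with l ≟ suc r
...   | yes e = ⊥-elim (b e)
...   | no _ = refl

swap-involutive : ∀ r l → swap r (swap r l) ≡ l
swap-involutive r l with swap-view r l
... | at-r refl      = trans (cong (swap r) (swap-r r)) (swap-suc-r r)
... | at-suc-r refl  = trans (cong (swap r) (swap-suc-r r)) (swap-r r)
... | elsewhere a b  = trans (cong (swap r) (swap-other r l a b)) (swap-other r l a b)

swap-injective : ∀ r {a b} → swap r a ≡ swap r b → a ≡ b
swap-injective r {a} {b} e =
  trans (sym (swap-involutive r a)) (trans (cong (swap r) e) (swap-involutive r b))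

swap-inRange : ∀ {N} r l → 1 ≤ r → suc r ≤ N → InRange N l → InRange N (swap r l)
swap-inRange r l r1 rN lr with swap-view r l
... | at-r refl     rewrite swap-r r     = s≤s z≤n , rN
... | at-suc-r refl rewrite swap-suc-r r = r1 , ≤-trans (n≤1+n r) rN
... | elsewhere a b rewrite swap-other r l a b = lr

swap-< : ∀ r u v → u < v → ¬ (u ≡ r × v ≡ suc r) → swap r u < swap r v
swap-< r u v u<v h with swap-view r u | swap-view r v
... | at-r refl     | at-r refl     = ⊥-elim (<-irrefl refl u<v)
... | at-r refl     | at-suc-r refl = ⊥-elim (h (refl , refl))
... | at-r refl     | elsewhere a b rewrite swap-r r | swap-other r v a b = ≤∧≢⇒< u<v (b ∘ sym)
... | at-suc-r refl | at-r refl     = ⊥-elim (<-asym u<v (n<1+n r))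
... | at-suc-r refl | at-suc-r refl = ⊥-elim (<-irrefl refl u<v)
... | at-suc-r refl | elsewhere a b rewrite swap-suc-r r | swap-other r v a b = <-trans (n<1+n r) u<v
... | elsewhere a b | at-r refl     rewrite swap-r r | swap-other r u a b = <-trans u<v (n<1+n r)
... | elsewhere a b | at-suc-r refl rewrite swap-suc-r r | swap-other r u a b = ≤∧≢⇒< (≤-pred u<v) a
... | elsewhere a b | elsewhere a' b' rewrite swap-other r u a b | swap-other r v a' b' = u<v

swap-+ : ∀ p m l → swap (p + m) (p + l) ≡ p + swap m l
swap-+ p m l with swap-view m l
... | at-r refl = trans (swap-r (p + m)) (trans (sym (+-suc p m)) (cong (p +_) (sym (swap-r m))))
... | at-suc-r refl =
  trans (cong (swap (p + m)) (+-suc p m)) (trans (swap-suc-r (p + m)) (cong (p +_) (sym (swap-suc-r m))))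
... | elsewhere a b =
  trans (swap-other (p + m) (p + l) (a ∘ +-cancelˡ-≡ p _ _) (b ∘ +-cancelˡ-≡ p _ _ ∘ λ e → trans e (sym (+-suc p m))))
        (cong (p +_) (sym (swap-other m l a b)))

if-yes : ∀ {a} {A : Set a} (d : Dec A) {B : Set} (u v : B) → A → (if does d then u else v) ≡ u
if-yes (yes _) u v _ = refl
if-yes (no ¬a) u v a = ⊥-elim (¬a a)

if-no : ∀ {a} {A : Set a} (d : Dec A) {B : Set} (u v : B) → ¬ A → (if does d then u else v) ≡ v
if-no (yes a) u v ¬a = ⊥-elim (¬a a)
if-no (no _) u v _ = refl

if-cong : ∀ {a b} {A : Set a} {B : Set b} (d₁ : Dec A) (d₂ : Dec B) {C : Set} {u₁ u₂ v₁ v₂ : C} →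
          (A → B) → (B → A) → u₁ ≡ u₂ → v₁ ≡ v₂ →
          (if does d₁ then u₁ else v₁) ≡ (if does d₂ then u₂ else v₂)
if-cong (yes a) (yes b) ab ba eu ev = eu
if-cong (yes a) (no nb) ab ba eu ev = ⊥-elim (nb (ab a))
if-cong (no na) (yes b) ab ba eu ev = ⊥-elim (na (ba b))
if-cong (no na) (no nb) ab ba eu ev = ev

if-idem : ∀ (b : Bool) {C : Set} (u : C) → (if b then u else u) ≡ u
if-idem true u = refl
if-idem false u = refl

module BenderKnuth {N : ℕ} (_≼_ : Fin N → Fin N → Set) (_≼?_ : Decidable _≼_) where
  open BKOps _≼_ _≼?_ using (t)

  LinExt : (Fin N → ℕ) → Set
  LinExt = IsLinearExtension _≼_

  incomparable? : Decidable (Incomparable _≼_)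
  incomparable? x y = ¬? (x ≼? y) ×-dec ¬? (y ≼? x)

  swapIfIncomparable : (f : Fin N → ℕ) (r : ℕ) (x y : Fin N) → Fin N → ℕ
  swapIfIncomparable f r x y z = if does (incomparable? x y) then swap r (f z) else f z

  -- t_r tests incomparability against every element labelled r + 1 (resp. r); on a linear
  -- extension these are just y (resp. x).
  t≗swapIfIncomparable : ∀ f → LinExt f → ∀ r {x y} → f x ≡ r → f y ≡ suc r →
                         t r f ≗ swapIfIncomparable f r x y
  t≗swapIfIncomparable f le r {x} {y} fx fy z with f z ≟ r
  ... | yes fz with IsLinearExtension.injective le z x (trans fz (sym fx))
  ...   | refl = if-cong (all? (λ w → (f w ≟ suc r) →-dec incomparable? z w)) (incomparable? z y)
             (λ h → h y fy)
             (λ inc w e → subst (Incomparable _≼_ z) (IsLinearExtension.injective le y w (trans fy (sym e))) inc)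
             refl (sym fz)
  t≗swapIfIncomparable f le r {x} {y} fx fy z | no _ with f z ≟ suc r
  ... | yes fz with IsLinearExtension.injective le z y (trans fz (sym fy))
  ...   | refl = if-cong (all? (λ w → (f w ≟ r) →-dec incomparable? z w)) (incomparable? x z)
             (λ h → let (a , b) = h x fx in b , a)
             (λ { (a , b) w e → subst (Incomparable _≼_ z) (IsLinearExtension.injective le x w (trans fx (sym e))) (b , a) })
             refl refl
  t≗swapIfIncomparable f le r {x} {y} fx fy z | no _ | no _ = sym (if-idem (does (incomparable? x y)) (f z))

  t-incomparable : ∀ f → LinExt f → ∀ r {x y} → f x ≡ r → f y ≡ suc r →
                   Incomparable _≼_ x y → t r f ≗ swap r ∘ f
  t-incomparable f le r {x} {y} fx fy inc z =
    trans (t≗swapIfIncomparable f le r fx fy z) (if-yes (incomparable? x y) _ _ inc)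

  t-comparable : ∀ f → LinExt f → ∀ r {x y} → f x ≡ r → f y ≡ suc r →
                 ¬ Incomparable _≼_ x y → t r f ≗ f
  t-comparable f le r {x} {y} fx fy ninc z =
    trans (t≗swapIfIncomparable f le r fx fy z) (if-no (incomparable? x y) _ _ ninc)

  linExt-resp-≗ : ∀ {f g} → f ≗ g → LinExt f → LinExt g
  linExt-resp-≗ {f} {g} e le = record
    { injective  = λ x y h → injective x y (trans (e x) (trans h (sym (e y))))
    ; in-range   = λ x → subst (InRange N) (e x) (in-range x)
    ; surjective = λ l l1 lN → let (x , fx) = surjective l l1 lN in x , trans (sym (e x)) fx
    ; monotone   = λ a b ab a≢b → subst₂ _<_ (e a) (e b) (monotone a b ab a≢b) }
    where open IsLinearExtension le

  swap-linExt : ∀ f → LinExt f → ∀ r {x y} → f x ≡ r → f y ≡ suc r →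
                1 ≤ r → suc r ≤ N → Incomparable _≼_ x y → LinExt (swap r ∘ f)
  swap-linExt f le r {x} {y} fx fy r1 rN (x⋠y , _) = record
    { injective  = λ a b h → injective a b (swap-injective r h)
    ; in-range   = λ a → swap-inRange r (f a) r1 rN (in-range a)
    ; surjective = λ l l1 lN → let (a1 , aN) = swap-inRange r l r1 rN (l1 , lN)
                                   (z , fz) = surjective (swap r l) a1 aN
                               in z , trans (cong (swap r) fz) (swap-involutive r l)
    ; monotone   = λ a b ab a≢b → swap-< r (f a) (f b) (monotone a b ab a≢b)
        (λ { (ea , eb) → x⋠y (subst₂ _≼_ (injective a x (trans ea (sym fx)))
                                         (injective b y (trans eb (sym fy))) ab) }) }
    where open IsLinearExtension le

  t-linExt : ∀ f → LinExt f → ∀ r → 1 ≤ r → suc r ≤ N → LinExt (t r f)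
  t-linExt f le r r1 rN with IsLinearExtension.surjective le r r1 (≤-trans (n≤1+n r) rN)
                           | IsLinearExtension.surjective le (suc r) (s≤s z≤n) rN
  ... | (x , fx) | (y , fy) with incomparable? x y
  ... | yes inc = linExt-resp-≗ (sym ∘ t-incomparable f le r fx fy inc) (swap-linExt f le r fx fy r1 rN inc)
  ... | no ninc = linExt-resp-≗ (sym ∘ t-comparable f le r fx fy ninc) le

module LabelCounting {N : ℕ} (_≼_ : Fin N → Fin N → Set) (f : Fin N → ℕ) (le : IsLinearExtension _≼_ f) where
  open IsLinearExtension le

  private
    fromℕ-injective : ∀ {a b c d} (lt₁ : a ∸ c < d) (lt₂ : b ∸ c < d) → c ≤ a → c ≤ b →
                      fromℕ< lt₁ ≡ fromℕ< lt₂ → a ≡ b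
    fromℕ-injective lt₁ lt₂ ca cb e =
      ∸-cancelʳ-≡ ca cb (trans (sym (toℕ-fromℕ< lt₁)) (trans (cong toℕ e) (toℕ-fromℕ< lt₂)))

  size<label : ∀ {s} (g : Fin s → Fin N) → (∀ a b → g a ≡ g b → a ≡ b) →
               ∀ z → (∀ w → f (g w) < f z) → s < f z
  size<label {s} g g-inj z lt = ≤-<-trans (FP.injective⇒≤ {f = h} h-inj) (∸-monoʳ-< {f z} {1} {0} (s≤s z≤n) fz1)
    where
      fz1 = proj₁ (in-range z)
      bound : ∀ w → f (g w) ∸ 1 < f z ∸ 1
      bound w = ∸-monoˡ-< (lt w) (proj₁ (in-range (g w)))
      h : Fin s → Fin (f z ∸ 1)
      h w = fromℕ< (bound w)
      h-inj : ∀ {a b} → h a ≡ h b → a ≡ b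
      h-inj {a} {b} e = g-inj a b (injective (g a) (g b)
        (fromℕ-injective (bound a) (bound b) (proj₁ (in-range (g a))) (proj₁ (in-range (g b))) e))

  label+size≤ : ∀ {s} (g : Fin s → Fin N) → (∀ a b → g a ≡ g b → a ≡ b) →
                ∀ z → (∀ w → f z < f (g w)) → f z + s ≤ N
  label+size≤ {s} g g-inj z lt =
    ≤-trans (+-monoʳ-≤ (f z) (FP.injective⇒≤ {f = h} h-inj)) (≤-reflexive (m+[n∸m]≡n (proj₂ (in-range z))))
    where
      bound : ∀ w → f (g w) ∸ suc (f z) < N ∸ f z
      bound w = ≤-<-trans (∸-monoˡ-≤ (suc (f z)) (proj₂ (in-range (g w))))
                  (∸-monoʳ-< {N} {suc (f z)} {f z} (n<1+n (f z)) (≤-trans (lt w) (proj₂ (in-range (g w)))))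
      h : Fin s → Fin (N ∸ f z)
      h w = fromℕ< (bound w)
      h-inj : ∀ {a b} → h a ≡ h b → a ≡ b
      h-inj {a} {b} e = g-inj a b (injective (g a) (g b) (fromℕ-injective (bound a) (bound b) (lt a) (lt b) e))

module OrdinalSum {p q : ℕ} (P : FinPoset p) (λs : List ℕ) (Q : FinPoset q) where
  n = sum λs
  N = p + (n + q)
  _≼_ = RLE P λs Q
  _≼?_ = RLE? P λs Q

  embP : Fin p → Fin N
  embP u = u ↑ˡ (n + q)
  embD : Fin n → Fin N
  embD d = inD p q d
  embQ : Fin q → Fin N
  embQ v = p ↑ʳ (n ↑ʳ v)
  embDQ : Fin (n + q) → Fin N
  embDQ w = p ↑ʳ w

  data Part (z : Fin N) : Set where
    fromP : ∀ u → z ≡ embP u → Part z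
    fromD : ∀ d → z ≡ embD d → Part z
    fromQ : ∀ v → z ≡ embQ v → Part z

  part : ∀ z → Part z
  part z with splitAt p z in e
  ... | inj₁ u = fromP u (sym (splitAt⁻¹-↑ˡ e))
  ... | inj₂ w with splitAt n w in e₂
  ...   | inj₁ d = fromD d (sym (trans (cong (p ↑ʳ_) (splitAt⁻¹-↑ˡ e₂)) (splitAt⁻¹-↑ʳ e)))
  ...   | inj₂ v = fromQ v (sym (trans (cong (p ↑ʳ_) (splitAt⁻¹-↑ʳ e₂)) (splitAt⁻¹-↑ʳ e)))

  embP≼embDQ : ∀ u w → embP u ≼ embDQ w
  embP≼embDQ u w rewrite splitAt-↑ˡ p u (n + q) | splitAt-↑ʳ p (n + q) w = tt
  embD≼embQ : ∀ d v → embD d ≼ embQ v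
  embD≼embQ d v rewrite splitAt-↑ʳ p (n + q) (d ↑ˡ q) | splitAt-↑ʳ p (n + q) (n ↑ʳ v)
                      | splitAt-↑ˡ n d q | splitAt-↑ʳ n q v = tt
  embD≼embD≡chainsLE : ∀ x y → (embD x ≼ embD y) ≡ chainsLE λs x y
  embD≼embD≡chainsLE x y rewrite splitAt-↑ʳ p (n + q) (x ↑ˡ q) | splitAt-↑ʳ p (n + q) (y ↑ˡ q)
                           | splitAt-↑ˡ n x q | splitAt-↑ˡ n y q = refl
  embP≼embP≡ : ∀ u u' → (embP u ≼ embP u') ≡ FinPoset._≼_ P u u'
  embP≼embP≡ u u' rewrite splitAt-↑ˡ p u (n + q) | splitAt-↑ˡ p u' (n + q) = refl
  embQ≼embQ≡ : ∀ v v' → (embQ v ≼ embQ v') ≡ FinPoset._≼_ Q v v'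
  embQ≼embQ≡ v v' rewrite splitAt-↑ʳ p (n + q) (n ↑ʳ v) | splitAt-↑ʳ p (n + q) (n ↑ʳ v')
                        | splitAt-↑ʳ n q v | splitAt-↑ʳ n q v' = refl
  embDQ⋠embP : ∀ w u → ¬ (embDQ w ≼ embP u)
  embDQ⋠embP w u h rewrite splitAt-↑ˡ p u (n + q) | splitAt-↑ʳ p (n + q) w = h
  embQ⋠embD : ∀ v d → ¬ (embQ v ≼ embD d)
  embQ⋠embD v d h rewrite splitAt-↑ʳ p (n + q) (n ↑ʳ v) | splitAt-↑ʳ p (n + q) (d ↑ˡ q)
                        | splitAt-↑ʳ n q v | splitAt-↑ˡ n d q = h

  embP≢embDQ : ∀ u w → embP u ≢ embDQ w
  embP≢embDQ u w e = <⇒≱ (subst (_< p) (sym (toℕ-↑ˡ u (n + q))) (toℕ<n u))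
                         (subst (λ z → p ≤ toℕ z) (sym e) (subst (p ≤_) (sym (toℕ-↑ʳ p w)) (m≤m+n p _)))
  embD≢embQ : ∀ d v → embD d ≢ embQ v
  embD≢embQ d v e = <⇒≱ (subst (_< n) (sym (toℕ-↑ˡ d q)) (toℕ<n d))
                        (subst (n ≤_) (trans (sym (toℕ-↑ʳ n v)) (cong toℕ (sym (↑ʳ-injective p _ _ e)))) (m≤m+n n _))

  embP-injective : ∀ a b → embP a ≡ embP b → a ≡ b
  embP-injective a b = ↑ˡ-injective (n + q) a b
  embD-injective : ∀ a b → embD a ≡ embD b → a ≡ b
  embD-injective a b e = ↑ˡ-injective q a b (↑ʳ-injective p _ _ e)
  embQ-injective : ∀ a b → embQ a ≡ embQ b → a ≡ b
  embQ-injective a b e = ↑ʳ-injective n a b (↑ʳ-injective p _ _ e)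
  embDQ-injective : ∀ a b → embDQ a ≡ embDQ b → a ≡ b
  embDQ-injective = ↑ʳ-injective p

  embPD : Fin (p + n) → Fin N
  embPD w with splitAt p w
  ... | inj₁ u = embP u
  ... | inj₂ d = embD d

  embPD-injective : ∀ a b → embPD a ≡ embPD b → a ≡ b
  embPD-injective a b e with splitAt p a in ea | splitAt p b in eb
  ... | inj₁ u | inj₁ u' = trans (sym (splitAt⁻¹-↑ˡ ea)) (trans (cong (_↑ˡ n) (embP-injective u u' e)) (splitAt⁻¹-↑ˡ eb))
  ... | inj₁ u | inj₂ d' = ⊥-elim (embP≢embDQ u _ e)
  ... | inj₂ d | inj₁ u' = ⊥-elim (embP≢embDQ u' _ (sym e))
  ... | inj₂ d | inj₂ d' = trans (sym (splitAt⁻¹-↑ʳ ea)) (trans (cong (p ↑ʳ_) (embD-injective d d' e)) (splitAt⁻¹-↑ʳ eb))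

  embPD≺embQ : ∀ w v → embPD w ≼ embQ v × embPD w ≢ embQ v
  embPD≺embQ w v with splitAt p w
  ... | inj₁ u = embP≼embDQ u _ , embP≢embDQ u _
  ... | inj₂ d = embD≼embQ d v , embD≢embQ d v

  module Blocks (f : Fin N → ℕ) (le : IsLinearExtension _≼_ f) where
    open IsLinearExtension le
    open LabelCounting _≼_ f le

    p<labelD : ∀ d → p < f (embD d)
    p<labelD d = size<label embP embP-injective (embD d)
                   (λ u → monotone _ _ (embP≼embDQ u _) (embP≢embDQ u _))
    labelD≤p+n : ∀ d → f (embD d) ≤ p + n
    labelD≤p+n d = +-cancelʳ-≤ q (f (embD d)) (p + n)
                     (subst (f (embD d) + q ≤_) (sym (+-assoc p n q))
                       (label+size≤ embQ embQ-injective (embD d) (λ v → monotone _ _ (embD≼embQ d v) (embD≢embQ d v))))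
    labelP≤p : ∀ u → f (embP u) ≤ p
    labelP≤p u = +-cancelʳ-≤ (n + q) (f (embP u)) p
                   (label+size≤ embDQ embDQ-injective (embP u) (λ w → monotone _ _ (embP≼embDQ u w) (embP≢embDQ u w)))
    p+n<labelQ : ∀ v → p + n < f (embQ v)
    p+n<labelQ v = size<label embPD embPD-injective (embQ v)
                     (λ w → monotone _ _ (proj₁ (embPD≺embQ w v)) (proj₂ (embPD≺embQ w v)))

    labelled-D : ∀ z → p < f z → f z ≤ p + n → Σ (Fin n) (λ d → z ≡ embD d)
    labelled-D z a b with part z
    ... | fromP u refl = ⊥-elim (<⇒≱ a (labelP≤p u))
    ... | fromD d e = d , e
    ... | fromQ v refl = ⊥-elim (<⇒≱ (p+n<labelQ v) b)

    labelled-P : ∀ z → f z ≤ p → Σ (Fin p) (λ u → z ≡ embP u)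
    labelled-P z a with part z
    ... | fromP u e = u , e
    ... | fromD d refl = ⊥-elim (<⇒≱ (p<labelD d) a)
    ... | fromQ v refl = ⊥-elim (<⇒≱ (≤-<-trans (m≤m+n p n) (p+n<labelQ v)) a)

    labelled-Q : ∀ z → p + n < f z → Σ (Fin q) (λ v → z ≡ embQ v)
    labelled-Q z a with part z
    ... | fromP u refl = ⊥-elim (<⇒≱ a (≤-trans (labelP≤p u) (m≤m+n p n)))
    ... | fromD d refl = ⊥-elim (<⇒≱ a (labelD≤p+n d))
    ... | fromQ v e = v , e

column : ∀ (λs : List ℕ) → Fin (sum λs) → ℕ
column [] ()
column (m ∷ λs) x with splitAt m x
... | inj₁ _ = 0
... | inj₂ u = suc (column λs u)

chainsLE⇒column≡ : ∀ λs x y → chainsLE λs x y → column λs x ≡ column λs y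
chainsLE⇒column≡ (m ∷ λs) x y h with splitAt m x | splitAt m y
... | inj₁ u | inj₁ v = refl
... | inj₂ u | inj₂ v = cong suc (chainsLE⇒column≡ λs u v h)

column≡⇒comparable : ∀ λs x y → column λs x ≡ column λs y → chainsLE λs x y ⊎ chainsLE λs y x
column≡⇒comparable (m ∷ λs) x y h with splitAt m x | splitAt m y
... | inj₁ u | inj₁ v = ≤-total (toℕ u) (toℕ v)
... | inj₁ u | inj₂ v = ⊥-elim (0≢1+n h)
... | inj₂ u | inj₁ v = ⊥-elim (0≢1+n (sym h))
... | inj₂ u | inj₂ v = column≡⇒comparable λs u v (suc-injective h)

-- σ r is the permutation of D-positions 1 … n induced by t_r when R = P ⊕ D ⊕ Q
-- (position l stands for label p + l); the composites mirror those of BKOps.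
module PositionPermutations (p n : ℕ) where
  σ : ℕ → ℕ → ℕ
  σ r l with p <? r | r <? p + n
  ... | yes _ | yes _ = swap (r ∸ p) l
  ... | _ | _ = l

  σ-inside : ∀ r l → p < r → r < p + n → σ r l ≡ swap (r ∸ p) l
  σ-inside r l a b with p <? r | r <? p + n
  ... | yes _ | yes _ = refl
  ... | no na | _ = ⊥-elim (na a)
  ... | yes _ | no nb = ⊥-elim (nb b)

  σ-outside : ∀ r l → ¬ (p < r × r < p + n) → σ r l ≡ l
  σ-outside r l h with p <? r | r <? p + n
  ... | yes a | yes b = ⊥-elim (h (a , b))
  ... | no _ | _ = refl
  ... | yes _ | no _ = refl

  σdown : ℕ → ℕ → ℕ
  σdown zero l = l
  σdown (suc a) l = σdown a (σ (suc a) l)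

  σq : ℕ → ℕ → ℕ
  σq zero l = l
  σq (suc a) l = σdown (suc a) (σq a l)

  σqjk : ℕ → ℕ → ℕ → ℕ
  σqjk j k l = σq (k ∸ 1) (σq (k ∸ j) (σq (k ∸ 1) l))

  σsq : ℕ → ℕ → ℕ → ℕ → ℕ
  σsq i j k l = σqjk j k (σ i (σqjk j k (σ i l)))

  σup : ℕ → ℕ → ℕ
  σup zero l = l
  σup (suc k) l = σ (p + suc k) (σup k l)

module Tracking {p q : ℕ} (P : FinPoset p) (λs : List ℕ) (Q : FinPoset q) where
  open OrdinalSum P λs Q
  open PositionPermutations p n public
  open BenderKnuth _≼_ _≼?_ public
  open BKOps _≼_ _≼?_ public

  -- The column word of h is that of h₀ read through Π.
  Tracks : (h₀ h : Fin n → ℕ) → (ℕ → ℕ) → Set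
  Tracks h₀ h Π = ∀ x y l → h x ≡ p + l → h₀ y ≡ p + Π l → column λs x ≡ column λs y

  tracks-resp : ∀ {h₀ g g' Π Π'} → g' ≗ g → (∀ x l → g x ≡ p + l → Π' l ≡ Π l) →
                Tracks h₀ g Π → Tracks h₀ g' Π'
  tracks-resp eg eΠ tr x y l e₁ e₂ =
    tr x y l (trans (sym (eg x)) e₁) (trans e₂ (cong (p +_) (eΠ x l (trans (sym (eg x)) e₁))))

  tracks-refl : ∀ f → LinExt f → Tracks (f ∘ embD) (f ∘ embD) id
  tracks-refl f le x y l e₁ e₂ =
    cong (column λs) (embD-injective x y (IsLinearExtension.injective le _ _ (trans e₁ (sym e₂))))

  comparable⇒column≡ : ∀ a b → ¬ Incomparable _≼_ (embD a) (embD b) → column λs a ≡ column λs b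
  comparable⇒column≡ a b ninc with column λs a ≟ column λs b
  ... | yes e = e
  ... | no ne = ⊥-elim (ninc (ne ∘ chainsLE⇒column≡ λs a b ∘ subst id (embD≼embD≡chainsLE a b) ,
                              ne ∘ sym ∘ chainsLE⇒column≡ λs b a ∘ subst id (embD≼embD≡chainsLE b a)))

  module _ (f : Fin N → ℕ) (le : LinExt f) where
    open IsLinearExtension le
    open Blocks f le

    labelD-surjective : ∀ l → InRange n l → Σ (Fin n) (λ d → f (embD d) ≡ p + l)
    labelD-surjective l (l1 , ln)
      with surjective (p + l) (≤-trans l1 (m≤n+m l p)) (+-monoʳ-≤ p (≤-trans ln (m≤m+n n q)))
    ... | z , fz with labelled-D z (subst (p <_) (sym fz) (m<m+n p l1))
                                  (subst (_≤ p + n) (sym fz) (+-monoʳ-≤ p ln))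
    ...   | d , refl = d , fz

    labelD-inRange : ∀ x l → f (embD x) ≡ p + l → InRange n l
    labelD-inRange x zero e = ⊥-elim (<-irrefl (trans (sym (+-identityʳ p)) (sym e)) (p<labelD x))
    labelD-inRange x (suc l) e = s≤s z≤n , +-cancelˡ-≤ p (suc l) n (subst (_≤ p + n) e (labelD≤p+n x))

    -- If t_r moved a D-label, r or r + 1 would be a D-label while the other is in P or Q.
    t-fixes-D-outside : ∀ r → 1 ≤ r → suc r ≤ N → ¬ (p < r × r < p + n) → ∀ d → t r f (embD d) ≡ f (embD d)
    t-fixes-D-outside r r1 rN outside d
      with surjective r r1 (≤-trans (n≤1+n r) rN) | surjective (suc r) (s≤s z≤n) rN
    ... | (x₀ , fx₀) | (y₀ , fy₀) with incomparable? x₀ y₀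
    ... | no ninc = t-comparable f le r fx₀ fy₀ ninc (embD d)
    ... | yes (x₀⋠y₀ , y₀⋠x₀) =
      trans (t-incomparable f le r fx₀ fy₀ (x₀⋠y₀ , y₀⋠x₀) (embD d)) (fixed (swap-view r (f (embD d))))
      where
      fixed : SwapView r (f (embD d)) → swap r (f (embD d)) ≡ f (embD d)
      fixed (elsewhere a b) = swap-other r _ a b
      fixed (at-r fd) = ⊥-elim (x₀⋠y₀ (subst₂ _≼_ (injective (embD d) x₀ (trans fd (sym fx₀))) (sym (proj₂ Y))
                                                  (embD≼embQ d (proj₁ Y))))
        where
        r≡p+n : r ≡ p + n
        r≡p+n with r <? p + n
        ... | yes r<p+n = ⊥-elim (outside (subst (p <_) fd (p<labelD d) , r<p+n))
        ... | no r≮p+n = ≤-antisym (subst (_≤ p + n) fd (labelD≤p+n d)) (≮⇒≥ r≮p+n)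
        Y = labelled-Q y₀ (subst (p + n <_) (sym fy₀) (s≤s (≤-reflexive (sym r≡p+n))))
      fixed (at-suc-r fd) = ⊥-elim (x₀⋠y₀ (subst₂ _≼_ (sym (proj₂ X)) (injective (embD d) y₀ (trans fd (sym fy₀)))
                                                      (embP≼embDQ (proj₁ X) _)))
        where
        r≡p : r ≡ p
        r≡p with p <? r
        ... | yes p<r = ⊥-elim (outside (p<r , subst (_≤ p + n) fd (labelD≤p+n d)))
        ... | no p≮r = ≤-antisym (≮⇒≥ p≮r) (≤-pred (subst (p <_) fd (p<labelD d)))
        X = labelled-P x₀ (≤-reflexive (trans fx₀ r≡p))

    -- Inside D, t_{p+m} either swaps positions m, m + 1 or leaves two comparable,
    -- hence equally coloured, elements in place: either way the column word is swapped.
    t-tracks-inside : ∀ h₀ m → 1 ≤ m → suc m ≤ n → ∀ Π →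
                      Tracks h₀ (f ∘ embD) Π → Tracks h₀ (t (p + m) f ∘ embD) (Π ∘ swap m)
    t-tracks-inside h₀ m m1 mn Π tr =
      let (d₀ , fd₀) = labelD-surjective m (m1 , ≤-trans (n≤1+n m) mn)
          (d₁ , fd₁) = labelD-surjective (suc m) (s≤s z≤n , mn)
      in via d₀ d₁ fd₀ fd₁
      where
      via : ∀ d₀ d₁ → f (embD d₀) ≡ p + m → f (embD d₁) ≡ p + suc m →
            Tracks h₀ (t (p + m) f ∘ embD) (Π ∘ swap m)
      via d₀ d₁ fd₀ fd₁ x y l e₁ e₂ with incomparable? (embD d₀) (embD d₁)
      ... | yes inc = tr x y (swap m l) moved e₂
        where
        open ≡-Reasoning
        moved : f (embD x) ≡ p + swap m l
        moved = begin
          f (embD x)                               ≡⟨ sym (swap-involutive (p + m) _) ⟩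
          swap (p + m) (swap (p + m) (f (embD x))) ≡⟨ cong (swap (p + m))
                                                      (sym (t-incomparable f le (p + m) fd₀
                                                            (trans fd₁ (+-suc p m)) inc (embD x))) ⟩
          swap (p + m) (t (p + m) f (embD x))      ≡⟨ cong (swap (p + m)) e₁ ⟩
          swap (p + m) (p + l)                     ≡⟨ swap-+ p m l ⟩
          p + swap m l                             ∎
      ... | no ninc with swap-view m l
      ...   | elsewhere a b = tr x y l unmoved (trans e₂ (cong (λ v → p + Π v) (swap-other m l a b)))
        where
        unmoved : f (embD x) ≡ p + l
        unmoved = trans (sym (t-comparable f le (p + m) fd₀ (trans fd₁ (+-suc p m)) ninc (embD x))) e₁
      ...   | at-r refl = trans (cong (column λs) x≡d₀)
                            (trans (comparable⇒column≡ d₀ d₁ ninc)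
                              (tr d₁ y (suc m) fd₁ (trans e₂ (cong (λ v → p + Π v) (swap-r m)))))
        where
        x≡d₀ : x ≡ d₀
        x≡d₀ = embD-injective x d₀ (injective _ _ (trans (sym (t-comparable f le (p + m) fd₀
                   (trans fd₁ (+-suc p m)) ninc (embD x))) (trans e₁ (sym fd₀))))
      ...   | at-suc-r refl = trans (cong (column λs) x≡d₁)
                                (trans (comparable⇒column≡ d₁ d₀ (ninc ∘ λ { (a , b) → b , a }))
                                  (tr d₀ y m fd₀ (trans e₂ (cong (λ v → p + Π v) (swap-suc-r m)))))
        where
        x≡d₁ : x ≡ d₁
        x≡d₁ = embD-injective x d₁ (injective _ _ (trans (sym (t-comparable f le (p + m) fd₀
                   (trans fd₁ (+-suc p m)) ninc (embD x))) (trans e₁ (sym fd₁))))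

    t-tracks-outside : ∀ h₀ r → 1 ≤ r → suc r ≤ N → ¬ (p < r × r < p + n) → ∀ Π →
                       Tracks h₀ (f ∘ embD) Π → Tracks h₀ (t r f ∘ embD) (Π ∘ σ r)
    t-tracks-outside h₀ r r1 rN out Π =
      tracks-resp (t-fixes-D-outside r r1 rN out) (λ x l _ → cong Π (σ-outside r l out))

    t-tracks : ∀ h₀ r → 1 ≤ r → suc r ≤ N → ∀ Π → Tracks h₀ (f ∘ embD) Π → Tracks h₀ (t r f ∘ embD) (Π ∘ σ r)
    t-tracks h₀ r r1 rN Π tr = by-position (p <? r) (r <? p + n)
      where
      by-position : Dec (p < r) → Dec (r < p + n) → Tracks h₀ (t r f ∘ embD) (Π ∘ σ r)
      by-position (yes p<r) (yes r<p+n) =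
        tracks-resp (λ x → cong (λ s → t s f (embD x)) r≡p+m) (λ x l _ → cong Π (σ-inside r l p<r r<p+n))
          (t-tracks-inside h₀ (r ∸ p) (m<n⇒0<n∸m p<r) (+-cancelˡ-< p _ n (subst (_< p + n) r≡p+m r<p+n)) Π tr)
        where
        r≡p+m : r ≡ p + (r ∸ p)
        r≡p+m = sym (m+[n∸m]≡n (<⇒≤ p<r))
      by-position (no p≮r) _ = t-tracks-outside h₀ r r1 rN (λ (a , _) → p≮r a) Π tr
      by-position (yes _) (no r≮p+n) = t-tracks-outside h₀ r r1 rN (λ (_ , b) → r≮p+n b) Π tr

  down-linExt : ∀ a f → LinExt f → a < N → LinExt (down a f)
  down-linExt zero f le _ = le
  down-linExt (suc a) f le aN = t-linExt (down a f) (down-linExt a f le (<-trans (n<1+n a) aN)) (suc a) (s≤s z≤n) aN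

  down-tracks : ∀ h₀ a f (le : LinExt f) (aN : a < N) Π →
                Tracks h₀ (f ∘ embD) Π → Tracks h₀ (down a f ∘ embD) (Π ∘ σdown a)
  down-tracks h₀ zero f le _ Π tr = tr
  down-tracks h₀ (suc a) f le aN Π tr =
    t-tracks (down a f) (down-linExt a f le a<N) h₀ (suc a) (s≤s z≤n) aN (Π ∘ σdown a) (down-tracks h₀ a f le a<N Π tr)
    where a<N = <-trans (n<1+n a) aN

  qq-linExt : ∀ a f → LinExt f → a < N → LinExt (qq a f)
  qq-linExt zero f le _ = le
  qq-linExt (suc a) f le aN = qq-linExt a (down (suc a) f) (down-linExt (suc a) f le aN) (<-trans (n<1+n a) aN)

  qq-tracks : ∀ h₀ a f (le : LinExt f) (aN : a < N) Π →
              Tracks h₀ (f ∘ embD) Π → Tracks h₀ (qq a f ∘ embD) (Π ∘ σq a)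
  qq-tracks h₀ zero f le _ Π tr = tr
  qq-tracks h₀ (suc a) f le aN Π tr =
    qq-tracks h₀ a (down (suc a) f) (down-linExt (suc a) f le aN) (<-trans (n<1+n a) aN) (Π ∘ σdown (suc a))
      (down-tracks h₀ (suc a) f le aN Π tr)

  qjk-linExt : ∀ j k f → LinExt f → k ∸ 1 < N → k ∸ j < N → LinExt (qjk j k f)
  qjk-linExt j k f le k₁ kⱼ =
    qq-linExt (k ∸ 1) _ (qq-linExt (k ∸ j) _ (qq-linExt (k ∸ 1) f le k₁) kⱼ) k₁

  qjk-tracks : ∀ h₀ j k f (le : LinExt f) (k₁ : k ∸ 1 < N) (kⱼ : k ∸ j < N) Π →
               Tracks h₀ (f ∘ embD) Π → Tracks h₀ (qjk j k f ∘ embD) (Π ∘ σqjk j k)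
  qjk-tracks h₀ j k f le k₁ kⱼ Π tr =
    qq-tracks h₀ (k ∸ 1) _ le₂ k₁ _ (qq-tracks h₀ (k ∸ j) _ le₁ kⱼ _ (qq-tracks h₀ (k ∸ 1) f le k₁ Π tr))
    where
    le₁ = qq-linExt (k ∸ 1) f le k₁
    le₂ = qq-linExt (k ∸ j) _ le₁ kⱼ

  sq-linExt : ∀ i j k f → LinExt f → 1 ≤ i → suc i ≤ N → k ∸ 1 < N → k ∸ j < N → LinExt (sq i j k f)
  sq-linExt i j k f le i1 iN k₁ kⱼ =
    t-linExt _ (qjk-linExt j k _ (t-linExt _ (qjk-linExt j k f le k₁ kⱼ) i i1 iN) k₁ kⱼ) i i1 iN

  sq-tracks : ∀ h₀ i j k f (le : LinExt f) (i1 : 1 ≤ i) (iN : suc i ≤ N) (k₁ : k ∸ 1 < N) (kⱼ : k ∸ j < N) Π →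
              Tracks h₀ (f ∘ embD) Π → Tracks h₀ (sq i j k f ∘ embD) (Π ∘ σsq i j k)
  sq-tracks h₀ i j k f le i1 iN k₁ kⱼ Π tr =
    t-tracks _ le₃ h₀ i i1 iN _ (qjk-tracks h₀ j k _ le₂ k₁ kⱼ _
      (t-tracks _ le₁ h₀ i i1 iN _ (qjk-tracks h₀ j k f le k₁ kⱼ Π tr)))
    where
    le₁ = qjk-linExt j k f le k₁ kⱼ
    le₂ = t-linExt _ le₁ i i1 iN
    le₃ = qjk-linExt j k _ le₂ k₁ kⱼ

  up : ℕ → (Fin N → ℕ) → Fin N → ℕ
  up zero f = f
  up (suc k) f = up k (t (p + suc k) f)

  up-linExt : ∀ k f → LinExt f → p + k < N → LinExt (up k f)
  up-linExt zero f le _ = le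
  up-linExt (suc k) f le kN =
    up-linExt k _ (t-linExt f le (p + suc k) (subst (1 ≤_) (sym (+-suc p k)) (s≤s z≤n)) kN)
      (<-trans (+-monoʳ-< p (n<1+n k)) kN)

  up-tracks : ∀ h₀ k f (le : LinExt f) (kN : p + k < N) Π →
              Tracks h₀ (f ∘ embD) Π → Tracks h₀ (up k f ∘ embD) (Π ∘ σup k)
  up-tracks h₀ zero f le _ Π tr = tr
  up-tracks h₀ (suc k) f le kN Π tr =
    up-tracks h₀ k _ (t-linExt f le (p + suc k) r1 kN) (<-trans (+-monoʳ-< p (n<1+n k)) kN) _
      (t-tracks f le h₀ (p + suc k) r1 kN Π tr)
    where r1 = subst (1 ≤_) (sym (+-suc p k)) (s≤s z≤n)

  tracks-sym : ∀ {h₀ h} → Tracks h₀ h id → Tracks h h₀ id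
  tracks-sym tr x y l e₁ e₂ = sym (tr y x l e₂ e₁)

  SameLabel : (g g₀ : Fin N → ℕ) → ℕ → Set
  SameLabel g g₀ l = ∀ x → g (embD x) ≡ p + l → g₀ (embD x) ≡ p + l

  module _ (g : Fin N → ℕ) (le : LinExt g) where
    open Blocks g le

    label-below : ∀ x l → g (embD x) < p + l → g (embD x) ∸ p < l × g (embD x) ≡ p + (g (embD x) ∸ p)
    label-below x l lt = +-cancelˡ-< p _ l (subst (_< p + l) g≡ lt) , g≡
      where g≡ = sym (m+[n∸m]≡n (<⇒≤ (p<labelD x)))

    chain-monotone : ∀ x y → chainsLE λs x y → x ≢ y → g (embD x) < g (embD y)
    chain-monotone x y h x≢y =
      IsLinearExtension.monotone le _ _ (subst id (sym (embD≼embD≡chainsLE x y)) h) (x≢y ∘ embD-injective x y)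

  -- The element labelled p + l by g is comparable to the one labelled p + l by g₀ (same column),
  -- and whichever of them is lower already carries, by induction, the same smaller label under both.
  same-label-step : ∀ g g₀ → LinExt g → LinExt g₀ → Tracks (g₀ ∘ embD) (g ∘ embD) id → ∀ l →
                    (∀ l' → l' < l → SameLabel g g₀ l' × SameLabel g₀ g l') → SameLabel g g₀ l
  same-label-step g g₀ le le₀ tr l ih x e with labelD-surjective g₀ le₀ l (labelD-inRange g le x l e)
  ... | y , e₀ with x FP.≟ y
  ...   | yes refl = e₀
  ...   | no x≢y with column≡⇒comparable λs x y (tr x y l e e₀)
  ...     | inj₁ x≤y = let (l'<l , g₀x≡) = label-below g₀ le₀ x l
                                            (subst (g₀ (embD x) <_) e₀ (chain-monotone g₀ le₀ x y x≤y x≢y))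
                       in ⊥-elim (<-irrefl (+-cancelˡ-≡ p _ _ (trans (sym (proj₂ (ih _ l'<l) x g₀x≡)) e)) l'<l)
  ...     | inj₂ y≤x = let (l'<l , gy≡) = label-below g le y l
                                           (subst (g (embD y) <_) e (chain-monotone g le y x y≤x (x≢y ∘ sym)))
                       in ⊥-elim (<-irrefl (+-cancelˡ-≡ p _ _ (trans (sym (proj₁ (ih _ l'<l) y gy≡)) e₀)) l'<l)

  columnWord-determines : ∀ f f₀ → LinExt f → LinExt f₀ → Tracks (f₀ ∘ embD) (f ∘ embD) id →
                          ∀ d → f (embD d) ≡ f₀ (embD d)
  columnWord-determines f f₀ le le₀ tr d =
    trans f≡ (sym (proj₁ (<-rec _ both (f (embD d) ∸ p)) d f≡))
    where
    f≡ = sym (m+[n∸m]≡n (<⇒≤ (Blocks.p<labelD f le d)))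
    both : ∀ l → (∀ {l'} → l' < l → SameLabel f f₀ l' × SameLabel f₀ f l') → SameLabel f f₀ l × SameLabel f₀ f l
    both l ih = same-label-step f f₀ le le₀ tr l (λ _ → ih) ,
                same-label-step f₀ f le₀ le (tracks-sym tr) l (λ l' l'<l → let (a , b) = ih l'<l in b , a)
cycle : ℕ → ℕ → ℕ
cycle M l with l ≤? M
... | yes _ = suc l
... | no _ with l ≟ suc M
...   | yes _ = 1
...   | no _ = l

cycle-≤ : ∀ M l → l ≤ M → cycle M l ≡ suc l
cycle-≤ M l h with l ≤? M
... | yes _ = refl
... | no nh = ⊥-elim (nh h)

cycle-suc : ∀ M → cycle M (suc M) ≡ 1
cycle-suc M with suc M ≤? M
... | yes h = ⊥-elim (<-irrefl refl h)
... | no _ with suc M ≟ suc M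
...   | yes _ = refl
...   | no ne = ⊥-elim (ne refl)

cycle-> : ∀ M l → suc M < l → cycle M l ≡ l
cycle-> M l h with l ≤? M
... | yes h2 = ⊥-elim (<-asym h (s≤s h2))
... | no _ with l ≟ suc M
...   | yes e = ⊥-elim (<-irrefl (sym e) h)
...   | no _ = refl

reverse : ℕ → ℕ → ℕ
reverse M l with l ≤? suc M
... | yes _ = suc (suc M) ∸ l
... | no _ = l

reverse-≤ : ∀ M l → l ≤ suc M → reverse M l ≡ suc (suc M) ∸ l
reverse-≤ M l h with l ≤? suc M
... | yes _ = refl
... | no nh = ⊥-elim (nh h)

reverse-> : ∀ M l → suc M < l → reverse M l ≡ l
reverse-> M l h with l ≤? suc M
... | yes h2 = ⊥-elim (<⇒≱ h h2)
... | no _ = refl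

fold-comm : ∀ {A : Set} (f : A → A) e x → fold (f x) f e ≡ f (fold x f e)
fold-comm f zero x = refl
fold-comm f (suc e) x = cong f (fold-comm f e x)

data Versus (M l : ℕ) : Set where
  below : l ≤ M → Versus M l
  at    : l ≡ suc M → Versus M l
  above : suc M < l → Versus M l

versus : ∀ M l → Versus M l
versus M l with l ≤? M
... | yes h = below h
... | no h with l ≟ suc M
...   | yes e = at e
...   | no ne = above (≤∧≢⇒< (≰⇒> h) (λ e → ne (sym e)))

cycle-0 : ∀ l → 1 ≤ l → cycle 0 l ≡ l
cycle-0 l l1 with versus 0 l
... | below h = ⊥-elim (<⇒≱ l1 h)
... | at refl = cycle-suc 0
... | above h = cycle-> 0 l h

cycle∘swap : ∀ M l → cycle M (swap (suc M) l) ≡ cycle (suc M) l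
cycle∘swap M l with swap-view (suc M) l
... | at-r refl = trans (cong (cycle M) (swap-r (suc M)))
                    (trans (cycle-> M (suc (suc M)) (s≤s (s≤s ≤-refl))) (sym (cycle-≤ (suc M) (suc M) ≤-refl)))
... | at-suc-r refl = trans (cong (cycle M) (swap-suc-r (suc M))) (trans (cycle-suc M) (sym (cycle-suc (suc M))))
... | elsewhere a b rewrite swap-other (suc M) l a b with versus M l
...   | below h = trans (cycle-≤ M l h) (sym (cycle-≤ (suc M) l (≤-trans h (n≤1+n M))))
...   | at e = ⊥-elim (a e)
...   | above h with versus (suc M) l
...     | below h2 = ⊥-elim (<⇒≱ h h2)
...     | at e = ⊥-elim (b e)
...     | above h2 = trans (cycle-> M l h) (sym (cycle-> (suc M) l h2))

reverse-0 : ∀ l → 1 ≤ l → reverse 0 l ≡ l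
reverse-0 l l1 with versus 0 l
... | below h = ⊥-elim (<⇒≱ l1 h)
... | at refl = reverse-≤ 0 1 ≤-refl
... | above h = reverse-> 0 l h

cycle∘reverse : ∀ M l → 1 ≤ l → cycle (suc M) (reverse M l) ≡ reverse (suc M) l
cycle∘reverse M l l1 with versus (suc M) l
... | below h = trans (cong (cycle (suc M)) (reverse-≤ M l h))
                (trans (cycle-≤ (suc M) _ (≤-trans (∸-monoʳ-≤ (suc (suc M)) l1) ≤-refl))
                  (trans (sym (+-∸-assoc 1 (≤-trans h (n≤1+n _))))
                    (sym (reverse-≤ (suc M) l (≤-trans h (n≤1+n _))))))
... | at refl = trans (cong (cycle (suc M)) (reverse-> M (suc (suc M)) ≤-refl))
                   (trans (cycle-suc (suc M)) (sym (trans (reverse-≤ (suc M) _ ≤-refl) (n∸n+1 (suc (suc M))))))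
  where
    n∸n+1 : ∀ k → suc k ∸ k ≡ 1
    n∸n+1 k = trans (+-∸-assoc 1 (≤-refl {k})) (cong suc (n∸n≡0 k))
... | above h = trans (cong (cycle (suc M)) (reverse-> M l (<-trans (n<1+n _) h)))
                (trans (cycle-> (suc M) l h) (sym (reverse-> (suc M) l h)))

reverse-involutive : ∀ M l → 1 ≤ l → reverse M (reverse M l) ≡ l
reverse-involutive M l l1 with l ≤? suc M
... | yes h = trans (reverse-≤ M _ (≤-trans (∸-monoʳ-≤ (suc (suc M)) l1) ≤-refl)) (m∸[m∸n]≡n (≤-trans h (n≤1+n _)))
... | no h = reverse-> M l (≰⇒> h)

reverse-inRange : ∀ M n l → suc M ≤ n → 1 ≤ l → l ≤ n → InRange n (reverse M l)
reverse-inRange M n l Mn l1 ln with l ≤? suc M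
... | yes h = m<n⇒0<n∸m (s≤s h) , ≤-trans (∸-monoʳ-≤ (suc (suc M)) l1) Mn
... | no h = l1 , ln

cycle-inRange : ∀ M n l → suc M ≤ n → 1 ≤ l → l ≤ n → InRange n (cycle M l)
cycle-inRange M n l Mn l1 ln with versus M l
... | below h rewrite cycle-≤ M l h = s≤s z≤n , ≤-trans (s≤s h) Mn
... | at refl rewrite cycle-suc M = s≤s z≤n , ≤-trans (s≤s z≤n) ln
... | above h rewrite cycle-> M l h = l1 , ln


module Rotation (n' : ℕ) where
  private
    n = suc n'

  rotate : ℕ → ℕ
  rotate = cycle n'

  rotate^ : ℕ → ℕ → ℕ
  rotate^ e x = fold x rotate e

  rotate⁻¹ : ℕ → ℕ
  rotate⁻¹ y with y ≟ 1
  ... | yes _ = n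
  ... | no _ = pred y

  rotate⁻¹^ : ℕ → ℕ → ℕ
  rotate⁻¹^ e x = fold x rotate⁻¹ e

  rotate⁻¹-1 : rotate⁻¹ 1 ≡ n
  rotate⁻¹-1 with 1 ≟ 1
  ... | yes _ = refl
  ... | no ne = ⊥-elim (ne refl)

  rotate⁻¹-suc : ∀ y → 1 ≤ y → rotate⁻¹ (suc y) ≡ y
  rotate⁻¹-suc y y1 with suc y ≟ 1
  ... | yes e = ⊥-elim (<-irrefl (sym (suc-injective e)) y1)
  ... | no _ = refl

  rotate^-inRange : ∀ e x → 1 ≤ x → x ≤ n → InRange n (rotate^ e x)
  rotate^-inRange zero x x1 xn = x1 , xn
  rotate^-inRange (suc e) x x1 xn = let (a , b) = rotate^-inRange e x x1 xn in cycle-inRange n' n _ ≤-refl a b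

  rotate⁻¹-inRange : ∀ y → 1 ≤ y → y ≤ n → InRange n (rotate⁻¹ y)
  rotate⁻¹-inRange (suc zero) _ _ rewrite rotate⁻¹-1 = s≤s z≤n , ≤-refl
  rotate⁻¹-inRange (suc (suc y)) _ yn rewrite rotate⁻¹-suc (suc y) (s≤s z≤n) = s≤s z≤n , ≤-trans (n≤1+n _) yn

  rotate⁻¹∘rotate : ∀ x → 1 ≤ x → x ≤ n → rotate⁻¹ (rotate x) ≡ x
  rotate⁻¹∘rotate x x1 xn with versus n' x
  ... | below h = trans (cong rotate⁻¹ (cycle-≤ n' x h)) (rotate⁻¹-suc x x1)
  ... | at refl = trans (cong rotate⁻¹ (cycle-suc n')) rotate⁻¹-1
  ... | above h = ⊥-elim (<⇒≱ h xn)

  rotate∘rotate⁻¹ : ∀ y → 1 ≤ y → y ≤ n → rotate (rotate⁻¹ y) ≡ y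
  rotate∘rotate⁻¹ (suc zero) _ _ = trans (cong rotate rotate⁻¹-1) (cycle-suc n')
  rotate∘rotate⁻¹ (suc (suc y)) _ yn = trans (cong rotate (rotate⁻¹-suc (suc y) (s≤s z≤n))) (cycle-≤ n' (suc y) (≤-pred yn))

  rotate^∘rotate⁻¹^ : ∀ e y → 1 ≤ y → y ≤ n → rotate^ e (rotate⁻¹^ e y) ≡ y
  rotate^∘rotate⁻¹^ zero y _ _ = refl
  rotate^∘rotate⁻¹^ (suc e) y y1 yn = let (a , b) = rotate⁻¹-inRange y y1 yn in
    trans (cong (rotate ∘ rotate^ e) (sym (fold-comm rotate⁻¹ e y)))
      (trans (cong rotate (rotate^∘rotate⁻¹^ e (rotate⁻¹ y) a b)) (rotate∘rotate⁻¹ y y1 yn))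

  rotate^∘rotate⁻¹ : ∀ e x → 1 ≤ x → x ≤ n → rotate^ e (rotate⁻¹ x) ≡ rotate⁻¹ (rotate^ e x)
  rotate^∘rotate⁻¹ e x x1 xn = let (a , b) = rotate⁻¹-inRange x x1 xn
                                   (c , d) = rotate^-inRange e (rotate⁻¹ x) a b in
    trans (sym (rotate⁻¹∘rotate _ c d))
      (cong rotate⁻¹ (trans (sym (fold-comm rotate e (rotate⁻¹ x))) (cong (rotate^ e) (rotate∘rotate⁻¹ x x1 xn))))

  reverse∘rotate : ∀ x → 1 ≤ x → x ≤ n → reverse n' (rotate x) ≡ rotate⁻¹ (reverse n' x)
  reverse∘rotate x x1 xn with versus n' x
  ... | below h = trans (cong (reverse n') (cycle-≤ n' x h)) (trans (reverse-≤ n' (suc x) (s≤s h))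
                  (sym (trans (cong rotate⁻¹ (reverse-≤ n' x xn))
                         (trans (cong rotate⁻¹ (+-∸-assoc 1 xn)) (rotate⁻¹-suc (n ∸ x) (m<n⇒0<n∸m (s≤s h)))))))
  ... | at refl = trans (cong (reverse n') (cycle-suc n')) (trans (reverse-≤ n' 1 (s≤s z≤n))
                  (sym (trans (cong rotate⁻¹ (trans (reverse-≤ n' n ≤-refl)
                         (trans (+-∸-assoc 1 (≤-refl {n})) (cong suc (n∸n≡0 n))))) rotate⁻¹-1)))
  ... | above h = ⊥-elim (<⇒≱ h xn)

  reverse∘rotate^ : ∀ e x → 1 ≤ x → x ≤ n → reverse n' (rotate^ e x) ≡ rotate⁻¹^ e (reverse n' x)
  reverse∘rotate^ zero x x1 xn = refl
  reverse∘rotate^ (suc e) x x1 xn = let (a , b) = rotate^-inRange e x x1 xn in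
    trans (reverse∘rotate _ a b) (cong rotate⁻¹ (reverse∘rotate^ e x x1 xn))

  rotate^∘reverse-involutive : ∀ e M l → (e ≡ 0 ⊎ M ≡ n') → 1 ≤ l → l ≤ n →
                               rotate^ e (reverse M (rotate^ e (reverse M l))) ≡ l
  rotate^∘reverse-involutive zero M l _ l1 ln = reverse-involutive M l l1
  rotate^∘reverse-involutive (suc e) .n' l (inj₂ refl) l1 ln =
    let (a , b) = reverse-inRange n' n l ≤-refl l1 ln in
    trans (cong (rotate^ (suc e)) (reverse∘rotate^ (suc e) (reverse n' l) a b))
      (trans (cong (rotate^ (suc e) ∘ rotate⁻¹^ (suc e)) (reverse-involutive n' l l1)) (rotate^∘rotate⁻¹^ (suc e) l l1 ln))

  modRep-0 : ∀ x → x % n ≡ 0 → modRep x n ≡ n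
  modRep-0 x e rewrite e = refl

  modRep-suc : ∀ x r → x % n ≡ suc r → modRep x n ≡ suc r
  modRep-suc x r e rewrite e = refl

  modRep-inRange : ∀ x → InRange n (modRep x n)
  modRep-inRange x with x % n in e
  ... | zero = s≤s z≤n , ≤-refl
  ... | suc r = s≤s z≤n , <⇒≤ (subst (_< n) e (m%n<n x n))

  module _ (n'≥1 : 1 ≤ n') where
    private
      suc-% : ∀ x → suc x % n ≡ suc (x % n) % n
      suc-% x = trans (%-distribˡ-+ 1 x n) (cong (λ v → (v + x % n) % n) (m<n⇒m%n≡m (s≤s n'≥1)))

    rotate-modRep : ∀ x → rotate (modRep x n) ≡ modRep (suc x) n
    rotate-modRep x with x % n in e
    ... | zero = trans (cycle-suc n')
                   (sym (modRep-suc (suc x) 0 (trans (suc-% x) (trans (cong (λ v → suc v % n) e) (m<n⇒m%n≡m (s≤s n'≥1))))))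
    ... | suc r with suc (suc r) <? n
    ...   | yes h = trans (cycle-≤ n' (suc r) (≤-pred (<⇒≤ h)))
                      (sym (modRep-suc (suc x) (suc r) (trans (suc-% x) (trans (cong (λ v → suc v % n) e) (m<n⇒m%n≡m h)))))
    ...   | no h = trans (cycle-≤ n' (suc r) (≤-pred r+2≤n))
                     (trans r+2≡n (sym (modRep-0 (suc x) (trans (suc-% x)
                       (trans (cong (λ v → suc v % n) e) (trans (cong (_% n) r+2≡n) (n%n≡0 n)))))))
      where
      r+2≤n : suc (suc r) ≤ n
      r+2≤n = subst (_< n) e (m%n<n x n)
      r+2≡n : suc (suc r) ≡ n
      r+2≡n = ≤-antisym r+2≤n (≮⇒≥ h)

    rotate^-modRep : ∀ x → rotate^ x n ≡ modRep x n
    rotate^-modRep zero = refl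
    rotate^-modRep (suc x) = trans (cong rotate (rotate^-modRep x)) (rotate-modRep x)

-- Closed forms on positions 1 … n (n = suc n'): t_{a} ⋯ t_1 acts on D as a cycle of its first
-- (a - p) ⊓ n' + 1 positions, and q_a as a reversal of them followed by a - (p + n') full rotations.
module PositionAlgebra (p n' : ℕ) where
  private
    n = suc n'
  open PositionPermutations p n public
  open Rotation n' public

  clip : ℕ → ℕ
  clip a = (a ∸ p) ⊓ n'

  clip-below : ∀ a → a ≤ p → clip a ≡ 0
  clip-below a h rewrite m≤n⇒m∸n≡0 h = refl

  clip-within : ∀ a → a ∸ p ≤ n' → clip a ≡ a ∸ p
  clip-within a h = m≤n⇒m⊓n≡m h

  clip-above : ∀ a → p + n' ≤ a → clip a ≡ n'
  clip-above a h = m≥n⇒m⊓n≡n (m+n≤o⇒m≤o∸n n' (subst (_≤ a) (+-comm p n') h))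

  σ-inRange : ∀ r l → 1 ≤ l → l ≤ n → InRange n (σ r l)
  σ-inRange r l l1 ln with p <? r | r <? p + n
  ... | yes a | yes b = swap-inRange (r ∸ p) l (m<n⇒0<n∸m a) (m<n+o⇒m∸n<o r p b) (l1 , ln)
  ... | no _ | _ = l1 , ln
  ... | yes _ | no _ = l1 , ln

  excess : ℕ → ℕ
  excess a = a ∸ (p + n')

  clip≤n' : ∀ a → clip a ≤ n'
  clip≤n' a = m⊓n≤n (a ∸ p) n'

  data Stage (a : ℕ) : Set where
    before : clip a ≡ 0 → clip (suc a) ≡ 0 → excess a ≡ 0 → excess (suc a) ≡ 0 → (∀ l → σ (suc a) l ≡ l) → Stage a
    during : clip (suc a) ≡ suc (clip a) → excess a ≡ 0 → excess (suc a) ≡ 0 →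
             (∀ l → σ (suc a) l ≡ swap (suc (clip a)) l) → Stage a
    after  : clip a ≡ n' → clip (suc a) ≡ n' → excess (suc a) ≡ suc (excess a) → (∀ l → σ (suc a) l ≡ l) → Stage a

  stage : ∀ a → Stage a
  stage a with suc a ≤? p | suc a ≤? p + n'
  ... | yes a<p | _ =
    before (clip-below a (<⇒≤ a<p)) (clip-below (suc a) a<p)
           (m≤n⇒m∸n≡0 (≤-trans (n≤1+n a) a<p+n')) (m≤n⇒m∸n≡0 a<p+n')
           (λ l → σ-outside (suc a) l (λ (p<a+1 , _) → <⇒≱ p<a+1 a<p))
    where a<p+n' = ≤-trans a<p (m≤m+n p n')
  ... | no a≮p | yes a<p+n' =
    during (trans (clip-within (suc a) a+1∸p≤n') (trans a+1∸p≡ (cong suc (sym (clip-within a a∸p≤n')))))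
           (m≤n⇒m∸n≡0 (≤-trans (n≤1+n a) a<p+n')) (m≤n⇒m∸n≡0 a<p+n')
           (λ l → trans (σ-inside (suc a) l (≰⇒> a≮p) (subst (suc a <_) (sym (+-suc p n')) (s≤s a<p+n')))
                        (cong (λ v → swap v l) (trans a+1∸p≡ (cong suc (sym (clip-within a a∸p≤n'))))))
    where
    p≤a = ≤-pred (≰⇒> a≮p)
    a+1∸p≡ : suc a ∸ p ≡ suc (a ∸ p)
    a+1∸p≡ = +-∸-assoc 1 p≤a
    a+1∸p≤n' = m≤n+o⇒m∸n≤o (suc a) p a<p+n'
    a∸p≤n' = ≤-trans (∸-monoˡ-≤ p (n≤1+n a)) a+1∸p≤n'
  ... | no _ | no a≮p+n' =
    after (clip-above a p+n'≤a) (clip-above (suc a) (≤-trans p+n'≤a (n≤1+n a))) (+-∸-assoc 1 p+n'≤a)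
          (λ l → σ-outside (suc a) l (λ (_ , a<p+n) → a≮p+n' (≤-pred (subst (suc a <_) (+-suc p n') a<p+n))))
    where p+n'≤a = ≤-pred (≰⇒> a≮p+n')

  σdown≡cycle : ∀ a l → 1 ≤ l → l ≤ n → σdown a l ≡ cycle (clip a) l
  σdown≡cycle zero l l1 ln rewrite 0∸n≡0 p = sym (cycle-0 l l1)
  σdown≡cycle (suc a) l l1 ln =
    trans (σdown≡cycle a (σ (suc a) l) (proj₁ σl-range) (proj₂ σl-range)) (by-stage (stage a))
    where
    σl-range = σ-inRange (suc a) l l1 ln
    by-stage : Stage a → cycle (clip a) (σ (suc a) l) ≡ cycle (clip (suc a)) l
    by-stage (before c₀ c₁ _ _ σ≡) = cong₂ cycle (trans c₀ (sym c₁)) (σ≡ l)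
    by-stage (during c₁ _ _ σ≡) =
      trans (cong (cycle (clip a)) (σ≡ l)) (trans (cycle∘swap (clip a) l) (cong (λ M → cycle M l) (sym c₁)))
    by-stage (after c₀ c₁ _ σ≡) = cong₂ cycle (trans c₀ (sym c₁)) (σ≡ l)

  rotate^∘reverse-inRange : ∀ e M l → M ≤ n' → 1 ≤ l → l ≤ n → InRange n (rotate^ e (reverse M l))
  rotate^∘reverse-inRange e M l M≤n' l1 ln = let (a , b) = reverse-inRange M n l (s≤s M≤n') l1 ln in rotate^-inRange e _ a b

  σq≡rotate^∘reverse : ∀ a l → 1 ≤ l → l ≤ n → σq a l ≡ rotate^ (excess a) (reverse (clip a) l)
  σq≡rotate^∘reverse zero l l1 ln rewrite 0∸n≡0 p | 0∸n≡0 (p + n') = sym (reverse-0 l l1)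
  σq≡rotate^∘reverse (suc a) l l1 ln =
    trans (σdown≡cycle (suc a) _ (proj₁ range) (proj₂ range))
      (trans (cong (cycle (clip (suc a))) (σq≡rotate^∘reverse a l l1 ln)) (by-stage (stage a)))
    where
    range = subst (InRange n) (sym (σq≡rotate^∘reverse a l l1 ln))
                  (rotate^∘reverse-inRange (excess a) (clip a) l (clip≤n' a) l1 ln)
    by-stage : Stage a → cycle (clip (suc a)) (rotate^ (excess a) (reverse (clip a) l))
                         ≡ rotate^ (excess (suc a)) (reverse (clip (suc a)) l)
    by-stage (before c₀ c₁ e₀ e₁ _) rewrite c₀ | c₁ | e₀ | e₁ =
      cycle-0 _ (proj₁ (reverse-inRange 0 n l (s≤s z≤n) l1 ln))
    by-stage (during c₁ e₀ e₁ _) rewrite c₁ | e₀ | e₁ = cycle∘reverse (clip a) l l1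
    by-stage (after c₀ c₁ e₁ _) rewrite c₀ | c₁ | e₁ = refl

  σq-inRange : ∀ a l → 1 ≤ l → l ≤ n → InRange n (σq a l)
  σq-inRange a l l1 ln = subst (InRange n) (sym (σq≡rotate^∘reverse a l l1 ln))
                                (rotate^∘reverse-inRange (excess a) (clip a) l (clip≤n' a) l1 ln)

  excess≡0⊎clip≡n' : ∀ a → excess a ≡ 0 ⊎ clip a ≡ n'
  excess≡0⊎clip≡n' a with excess a ≟ 0
  ... | yes e = inj₁ e
  ... | no ne = inj₂ (clip-above a (≤-pred (≤-trans (m∸n≢0⇒n<m ne) (n≤1+n a))))

  σq-involutive : ∀ a l → 1 ≤ l → l ≤ n → σq a (σq a l) ≡ l
  σq-involutive a l l1 ln = let (x , y) = σq-inRange a l l1 ln in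
    trans (σq≡rotate^∘reverse a _ x y) (trans (cong (λ v → rotate^ (excess a) (reverse (clip a) v)) (σq≡rotate^∘reverse a l l1 ln))
      (rotate^∘reverse-involutive (excess a) (clip a) l (excess≡0⊎clip≡n' a) l1 ln))

  σqjk-involutive : ∀ j k l → 1 ≤ l → l ≤ n → σqjk j k (σqjk j k l) ≡ l
  σqjk-involutive j k l l1 ln =
    let (a , b) = σq-inRange (k ∸ 1) l l1 ln
        (c , d) = σq-inRange (k ∸ j) _ a b in
    trans (cong (λ v → σq (k ∸ 1) (σq (k ∸ j) v)) (σq-involutive (k ∸ 1) _ c d))
      (trans (cong (σq (k ∸ 1)) (σq-involutive (k ∸ j) _ a b)) (σq-involutive (k ∸ 1) l l1 ln))


InPair : ℕ → ℕ → Set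
InPair m y = y ≡ m ⊎ y ≡ suc m

-- An involution mapping m and m + 1 into {m, m + 1} commutes with the transposition of m and m + 1.
swap-conjugate-cancels : ∀ {n} (Φ : ℕ → ℕ) → (∀ l → 1 ≤ l → l ≤ n → Φ (Φ l) ≡ l) →
                         ∀ m → 1 ≤ m → suc m ≤ n → InPair m (Φ m) → InPair m (Φ (suc m)) →
                         ∀ l → 1 ≤ l → l ≤ n → Φ (swap m (Φ (swap m l))) ≡ l
swap-conjugate-cancels Φ inv m m1 mn Φm Φm+1 l l1 ln with swap-view m l
... | elsewhere l≢m l≢m+1 =
  trans (cong (Φ ∘ swap m ∘ Φ) (swap-other m l l≢m l≢m+1))
    (trans (cong Φ (swap-other m (Φ l) (outside Φm) (outside Φm+1))) (inv l l1 ln))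
  where
  outside : ∀ {x} → InPair m (Φ x) → Φ l ≢ x
  outside h e = [ l≢m , l≢m+1 ]′ (Data.Sum.map (λ e₂ → trans (sym (inv l l1 ln)) (trans (cong Φ e) e₂))
                                                (λ e₂ → trans (sym (inv l l1 ln)) (trans (cong Φ e) e₂)) h)
... | at-r refl with Φm+1 | Φm
...   | inj₁ e | _ = trans (cong (Φ ∘ swap m ∘ Φ) (swap-r m)) (trans (cong (Φ ∘ swap m) e) (trans (cong Φ (swap-r m)) e))
...   | inj₂ e | inj₁ e' = trans (cong (Φ ∘ swap m ∘ Φ) (swap-r m)) (trans (cong (Φ ∘ swap m) e) (trans (cong Φ (swap-suc-r m)) e'))
...   | inj₂ e | inj₂ e' = ⊥-elim (1+n≢n (sym (trans (sym (inv m m1 (≤-trans (n≤1+n m) mn))) (trans (cong Φ e') e))))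
swap-conjugate-cancels Φ inv m m1 mn Φm Φm+1 l l1 ln | at-suc-r refl with Φm | Φm+1
...   | inj₂ e | _ = trans (cong (Φ ∘ swap m ∘ Φ) (swap-suc-r m)) (trans (cong (Φ ∘ swap m) e) (trans (cong Φ (swap-suc-r m)) e))
...   | inj₁ e | inj₂ e' = trans (cong (Φ ∘ swap m ∘ Φ) (swap-suc-r m)) (trans (cong (Φ ∘ swap m) e) (trans (cong Φ (swap-r m)) e'))
...   | inj₁ e | inj₁ e' = ⊥-elim (1+n≢n (trans (sym (inv (suc m) (s≤s z≤n) mn)) (trans (cong Φ e') e)))

-- A gap k - j > p between the two indices, with i + 2 ≤ j and k ≤ 2p + 4, leaves no slack.
critical-indices : ∀ p i j k → p < i → suc i < j → k ≤ p + (p + 4) → p < k ∸ j →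
                   i ≡ p + 1 × j ≡ p + 3 × k ≡ p + (p + 4)
critical-indices p i j k p<i i+1<j k≤ gap
  with m≤n⇒∃[o]m+o≡n p<i | m≤n⇒∃[o]m+o≡n i+1<j | m≤n⇒∃[o]m+o≡n (m≤o∸n⇒m+n≤o (suc p) {j} {k} j≤k gap)
  where
  j≤k : j ≤ k
  j≤k = <⇒≤ (m∸n≢0⇒n<m (λ e → n≮0 (subst (p <_) e gap)))
... | i₀ , refl | j₀ , refl | k₀ , refl with offsets≡0 i₀ j₀ k₀ (n≤0⇒n≡0 (+-cancelˡ-≤ (p + (p + 4)) _ 0
                       (subst₂ _≤_ (rearrange p i₀ j₀ k₀) (sym (+-identityʳ _)) k≤)))
  where
  rearrange : ∀ p i₀ j₀ k₀ → suc p + (suc (suc (suc p + i₀)) + j₀) + k₀ ≡ p + (p + 4) + (i₀ + j₀ + k₀)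
  rearrange = solve-∀
  offsets≡0 : ∀ a b c → a + b + c ≡ 0 → a ≡ 0 × b ≡ 0 × c ≡ 0
  offsets≡0 zero zero zero _ = refl , refl , refl
  offsets≡0 zero zero (suc _) ()
  offsets≡0 zero (suc _) _ ()
  offsets≡0 (suc _) _ _ ()
... | refl , refl , refl = i≡ p , j≡ p , k≡ p
  where
  i≡ : ∀ p → suc p + 0 ≡ p + 1
  i≡ = solve-∀
  j≡ : ∀ p → suc (suc (suc p + 0)) + 0 ≡ p + 3
  j≡ = solve-∀
  k≡ : ∀ p → suc p + (suc (suc (suc p + 0)) + 0) + 0 ≡ p + (p + 4)
  k≡ = solve-∀

module SquareOnPositions (p n' : ℕ) (n'≥3 : 3 ≤ n') where
  private
    n = suc n'
    n'≥1 : 1 ≤ n'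
    n'≥1 = ≤-trans (s≤s z≤n) n'≥3
    n≥3 : 3 ≤ n
    n≥3 = ≤-trans n'≥3 (n≤1+n n')
  open PositionAlgebra p n' public

  σ-involutive : ∀ r l → σ r (σ r l) ≡ l
  σ-involutive r l with p <? r | r <? p + n
  ... | yes _ | yes _ = swap-involutive (r ∸ p) l
  ... | no _ | _ = refl
  ... | yes _ | no _ = refl

  σ-p+1 : ∀ l → σ (p + 1) l ≡ swap 1 l
  σ-p+1 l = trans (σ-inside (p + 1) l (m<m+n p (s≤s z≤n)) (+-monoʳ-< p (s≤s n'≥1)))
              (cong (λ v → swap v l) (m+n∸m≡n p 1))

  σq-fixes-below : ∀ a → a ≤ p → ∀ l → 1 ≤ l → l ≤ n → σq a l ≡ l
  σq-fixes-below a a≤p l l1 ln =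
    trans (σq≡rotate^∘reverse a l l1 ln)
      (trans (cong₂ (λ e M → rotate^ e (reverse M l)) (m≤n⇒m∸n≡0 (≤-trans a≤p (m≤m+n p n'))) (clip-below a a≤p))
        (reverse-0 l l1))

  σqjk-fixes-small-gap : ∀ j k → k ∸ j ≤ p → ∀ l → 1 ≤ l → l ≤ n → σqjk j k l ≡ l
  σqjk-fixes-small-gap j k gap l l1 ln = let (a , b) = σq-inRange (k ∸ 1) l l1 ln in
    trans (cong (σq (k ∸ 1)) (σq-fixes-below (k ∸ j) gap _ a b)) (σq-involutive (k ∸ 1) l l1 ln)

  -- For i = p + 1, j = p + 3, k = N, q_{k-1} acts on positions as l ↦ (n + 1 - l) + q mod n and
  -- q_{k-j} = q_{p+1} swaps positions 1 and 2.
  module Critical (q : ℕ) (q+n≡p+4 : q + n ≡ p + 4) where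
    K = p + (n + q)
    r = modRep q n

    outer : ℕ → ℕ
    outer = σq (K ∸ 1)

    inner : ℕ → ℕ
    inner = σq (p + 1)

    σqjk≡outer∘inner∘outer : ∀ l → σqjk (p + 3) K l ≡ outer (inner (outer l))
    σqjk≡outer∘inner∘outer l = cong (λ b → σq (K ∸ 1) (σq b (σq (K ∸ 1) l))) K∸[p+3]≡p+1
      where
      K∸[p+3]≡p+1 : K ∸ (p + 3) ≡ p + 1
      K∸[p+3]≡p+1 = begin
        p + (n + q) ∸ (p + 3) ≡⟨ cong (λ v → p + v ∸ (p + 3)) (trans (+-comm n q) q+n≡p+4) ⟩
        p + (p + 4) ∸ (p + 3) ≡⟨ [m+n]∸[m+o]≡n∸o p (p + 4) 3 ⟩
        p + 4 ∸ 3             ≡⟨ cong (_∸ 3) (+-comm p 4) ⟩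
        1 + p                 ≡⟨ +-comm 1 p ⟩
        p + 1                 ∎
        where open ≡-Reasoning

    outer≡ : ∀ x → 1 ≤ x → x ≤ n → outer x ≡ rotate^ q (reverse n' x)
    outer≡ x x1 xn =
      trans (cong (λ a → σq a x) (cong (_∸ 1) (+-suc p (n' + q))))
        (trans (σq≡rotate^∘reverse _ x x1 xn) (cong₂ (λ e M → rotate^ e (reverse M x)) excess≡q clip≡n'))
      where
      excess≡q : excess (p + (n' + q)) ≡ q
      excess≡q = trans (cong (_∸ (p + n')) (sym (+-assoc p n' q))) (m+n∸m≡n (p + n') q)
      clip≡n' : clip (p + (n' + q)) ≡ n'
      clip≡n' = clip-above _ (+-monoʳ-≤ p (m≤m+n n' q))

    outer-1 : outer 1 ≡ r
    outer-1 = trans (outer≡ 1 (s≤s z≤n) (s≤s z≤n))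
                (trans (cong (rotate^ q) (reverse-≤ n' 1 (s≤s z≤n))) (rotate^-modRep n'≥1 q))

    outer-2 : outer 2 ≡ rotate⁻¹ r
    outer-2 = trans (outer≡ 2 (s≤s z≤n) 2≤n)
                (trans (cong (rotate^ q) (trans (reverse-≤ n' 2 2≤n) (sym (rotate⁻¹-suc n' n'≥1))))
                  (trans (rotate^∘rotate⁻¹ q n (s≤s z≤n) ≤-refl) (cong rotate⁻¹ (rotate^-modRep n'≥1 q))))
      where
      2≤n : 2 ≤ n
      2≤n = ≤-trans (s≤s (s≤s z≤n)) n≥3

    outer-involutive : ∀ x → 1 ≤ x → x ≤ n → outer (outer x) ≡ x
    outer-involutive = σq-involutive (K ∸ 1)

    inner≡ : ∀ x → 1 ≤ x → x ≤ n → inner x ≡ reverse 1 x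
    inner≡ x x1 xn = trans (σq≡rotate^∘reverse _ x x1 xn) (cong₂ (λ e M → rotate^ e (reverse M x)) excess≡0 clip≡1)
      where
      excess≡0 : excess (p + 1) ≡ 0
      excess≡0 = m≤n⇒m∸n≡0 (+-monoʳ-≤ p n'≥1)
      clip≡1 : clip (p + 1) ≡ 1
      clip≡1 = trans (clip-within _ (subst (_≤ n') (sym (m+n∸m≡n p 1)) n'≥1)) (m+n∸m≡n p 1)

    inner-1 : inner 1 ≡ 2
    inner-1 = trans (inner≡ 1 (s≤s z≤n) (s≤s z≤n)) (reverse-≤ 1 1 (s≤s z≤n))

    inner-2 : inner 2 ≡ 1
    inner-2 = trans (inner≡ 2 (s≤s z≤n) (≤-trans (s≤s (s≤s z≤n)) n≥3)) (reverse-≤ 1 2 ≤-refl)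

    inner-≥3 : ∀ x → 3 ≤ x → x ≤ n → inner x ≡ x
    inner-≥3 x x3 xn = trans (inner≡ x (≤-trans (s≤s z≤n) x3) xn) (reverse-> 1 x x3)

    σsq-critical≡ : ∀ l → σsq (p + 1) (p + 3) K l ≡ σqjk (p + 3) K (swap 1 (σqjk (p + 3) K (swap 1 l)))
    σsq-critical≡ l = trans (cong (λ v → σqjk (p + 3) K (σ (p + 1) (σqjk (p + 3) K v))) (σ-p+1 l))
                        (cong (σqjk (p + 3) K) (σ-p+1 _))

    σqjk-1,2-inPair : r ≢ 1 → r ≢ 3 → InPair 1 (σqjk (p + 3) K 1) × InPair 1 (σqjk (p + 3) K 2)
    σqjk-1,2-inPair r≢1 r≢3 = by-value r refl (modRep-inRange q)
      where
      Φ≡ = σqjk≡outer∘inner∘outer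
      by-value : ∀ v → r ≡ v → InRange n v → InPair 1 (σqjk (p + 3) K 1) × InPair 1 (σqjk (p + 3) K 2)
      by-value 1 e _ = ⊥-elim (r≢1 e)
      by-value 2 e _ =
        inj₂ (trans (Φ≡ 1) (trans (cong (outer ∘ inner) o1) (trans (cong outer inner-2) o1))) ,
        inj₁ (trans (Φ≡ 2) (trans (cong (outer ∘ inner) o2) (trans (cong outer inner-1) o2)))
        where
        o1 = trans outer-1 e
        o2 = trans outer-2 (trans (cong rotate⁻¹ e) (rotate⁻¹-suc 1 (s≤s z≤n)))
      by-value 3 e _ = ⊥-elim (r≢3 e)
      by-value (suc (suc (suc (suc v)))) e (_ , v≤n) =
        inj₁ (trans (Φ≡ 1) (trans (cong outer (trans (cong inner o1) (trans (inner-≥3 _ (s≤s (s≤s (s≤s z≤n))) v≤n) (sym o1))))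
                              (outer-involutive 1 (s≤s z≤n) (s≤s z≤n)))) ,
        inj₂ (trans (Φ≡ 2) (trans (cong outer (trans (cong inner o2)
                                (trans (inner-≥3 _ (s≤s (s≤s (s≤s z≤n))) (≤-trans (n≤1+n _) v≤n)) (sym o2))))
                              (outer-involutive 2 (s≤s z≤n) (≤-trans (s≤s (s≤s z≤n)) n≥3))))
        where
        o1 = trans outer-1 e
        o2 = trans outer-2 (trans (cong rotate⁻¹ e) (rotate⁻¹-suc _ (s≤s z≤n)))

    σsq-critical-fixes : r ≢ 1 → r ≢ 3 → ∀ l → 1 ≤ l → l ≤ n → σsq (p + 1) (p + 3) K l ≡ l
    σsq-critical-fixes r≢1 r≢3 l l1 ln =
      trans (σsq-critical≡ l)
        (swap-conjugate-cancels (σqjk (p + 3) K) (σqjk-involutive (p + 3) K) 1 (s≤s z≤n) (≤-trans (s≤s (s≤s z≤n)) n≥3)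
          (proj₁ inPair) (proj₂ inPair) l l1 ln)
      where inPair = σqjk-1,2-inPair r≢1 r≢3

    σsq-critical-moves-2 : r ≡ 1 → σsq (p + 1) (p + 3) K 2 ≡ 1
    σsq-critical-moves-2 e = begin
      σsq (p + 1) (p + 3) K 2                 ≡⟨ σsq-critical≡ 2 ⟩
      Φ (swap 1 (Φ (swap 1 2)))               ≡⟨ cong (Φ ∘ swap 1 ∘ Φ) (swap-suc-r 1) ⟩
      Φ (swap 1 (Φ 1))                        ≡⟨ cong (Φ ∘ swap 1) Φ1≡n ⟩
      Φ (swap 1 n)                            ≡⟨ cong Φ (swap-other 1 n (λ h → <-irrefl (sym h) (≤-trans (s≤s (s≤s z≤n)) n≥3))
                                                                      (λ h → <-irrefl (sym h) n≥3)) ⟩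
      Φ n                                     ≡⟨ Φn≡1 ⟩
      1                                       ∎
      where
      open ≡-Reasoning
      Φ = σqjk (p + 3) K
      o1 = trans outer-1 e
      o2 : outer 2 ≡ n
      o2 = trans outer-2 (trans (cong rotate⁻¹ e) rotate⁻¹-1)
      on : outer n ≡ 2
      on = trans (cong outer (sym o2)) (outer-involutive 2 (s≤s z≤n) (≤-trans (s≤s (s≤s z≤n)) n≥3))
      Φ1≡n : Φ 1 ≡ n
      Φ1≡n = trans (σqjk≡outer∘inner∘outer 1) (trans (cong (outer ∘ inner) o1) (trans (cong outer inner-1) o2))
      Φn≡1 : Φ n ≡ 1
      Φn≡1 = trans (σqjk≡outer∘inner∘outer n) (trans (cong (outer ∘ inner) on) (trans (cong outer inner-2) o1))

    σsq-critical-moves-1 : r ≡ 3 → σsq (p + 1) (p + 3) K 1 ≡ 2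
    σsq-critical-moves-1 e = begin
      σsq (p + 1) (p + 3) K 1                 ≡⟨ σsq-critical≡ 1 ⟩
      Φ (swap 1 (Φ (swap 1 1)))               ≡⟨ cong (Φ ∘ swap 1 ∘ Φ) (swap-r 1) ⟩
      Φ (swap 1 (Φ 2))                        ≡⟨ cong (Φ ∘ swap 1) Φ2≡3 ⟩
      Φ (swap 1 3)                            ≡⟨ cong Φ (swap-other 1 3 (λ ()) (λ ())) ⟩
      Φ 3                                     ≡⟨ Φ3≡2 ⟩
      2                                       ∎
      where
      open ≡-Reasoning
      Φ = σqjk (p + 3) K
      o1 = trans outer-1 e
      o2 : outer 2 ≡ 2
      o2 = trans outer-2 (trans (cong rotate⁻¹ e) (rotate⁻¹-suc 2 (s≤s z≤n)))
      o3 : outer 3 ≡ 1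
      o3 = trans (cong outer (sym o1)) (outer-involutive 1 (s≤s z≤n) (s≤s z≤n))
      Φ2≡3 : Φ 2 ≡ 3
      Φ2≡3 = trans (σqjk≡outer∘inner∘outer 2) (trans (cong (outer ∘ inner) o2) (trans (cong outer inner-2) o1))
      Φ3≡2 : Φ 3 ≡ 2
      Φ3≡2 = trans (σqjk≡outer∘inner∘outer 3) (trans (cong (outer ∘ inner) o3) (trans (cong outer inner-1) o2))

  σsq-fixes : ∀ q i j k → q + n ≡ p + 4 → modRep q n ≢ 1 → modRep q n ≢ 3 →
              suc i < j → k ≤ p + (n + q) → ∀ l → 1 ≤ l → l ≤ n → σsq i j k l ≡ l
  σsq-fixes q i j k q+n≡ r≢1 r≢3 i+1<j k≤N l l1 ln = by-position (p <? i) (i <? p + n)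
    where
    Φ = σqjk j k
    outside : ¬ (p < i × i < p + n) → σsq i j k l ≡ l
    outside out = trans (cong (λ v → Φ (σ i (Φ v))) (σ-outside i l out))
                    (trans (cong Φ (σ-outside i _ out)) (σqjk-involutive j k l l1 ln))
    inside : p < i → σsq i j k l ≡ l
    inside p<i with k ∸ j ≤? p
    ... | yes small = trans (cong (Φ ∘ σ i) (σqjk-fixes-small-gap j k small _ σil₁ σilₙ))
                        (trans (σqjk-fixes-small-gap j k small _ σσil₁ σσilₙ) (σ-involutive i l))
      where
      σil₁ = proj₁ (σ-inRange i l l1 ln)
      σilₙ = proj₂ (σ-inRange i l l1 ln)
      σσil₁ = proj₁ (σ-inRange i _ σil₁ σilₙ)
      σσilₙ = proj₂ (σ-inRange i _ σil₁ σilₙ)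
    ... | no large with critical-indices p i j k p<i i+1<j (subst (λ v → k ≤ p + v) (trans (+-comm n q) q+n≡) k≤N) (≰⇒> large)
    ...   | refl , refl , k≡ =
      trans (cong (λ v → σsq (p + 1) (p + 3) v l) (trans k≡ (cong (p +_) (sym (trans (+-comm n q) q+n≡)))))
        (Critical.σsq-critical-fixes q q+n≡ r≢1 r≢3 l l1 ln)
    by-position : Dec (p < i) → Dec (i < p + n) → σsq i j k l ≡ l
    by-position (no p≮i) _ = outside (λ (a , _) → p≮i a)
    by-position (yes _) (no i≮p+n) = outside (λ (_ , b) → i≮p+n b)
    by-position (yes p<i) (yes _) = inside p<i

  σup-1 : ∀ k → k ≤ n' → σup k 1 ≡ suc k
  σup-1 zero _ = refl
  σup-1 (suc k) h = trans (cong (σ (p + suc k)) (σup-1 k (≤-trans (n≤1+n k) h)))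
                      (trans (σ-inside (p + suc k) (suc k) (m<m+n p (s≤s z≤n)) (+-monoʳ-< p (s≤s h)))
                        (trans (cong (λ v → swap v (suc k)) (m+n∸m≡n p (suc k))) (swap-r (suc k))))

  σup-2 : ∀ k → 1 ≤ k → k ≤ n' → σup k 2 ≡ 1
  σup-2 (suc zero) _ h = trans (σ-inside (p + 1) 2 (m<m+n p (s≤s z≤n)) (+-monoʳ-< p (s≤s h)))
                           (trans (cong (λ v → swap v 2) (m+n∸m≡n p 1)) (swap-suc-r 1))
  σup-2 (suc (suc k)) _ h = trans (cong (σ (p + suc (suc k))) (σup-2 (suc k) (s≤s z≤n) (≤-trans (n≤1+n _) h)))
                              (trans (σ-inside (p + suc (suc k)) 1 (m<m+n p (s≤s z≤n)) (+-monoʳ-< p (s≤s h)))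
                                (trans (cong (λ v → swap v 1) (m+n∸m≡n p (suc (suc k)))) (swap-other (suc (suc k)) 1 (λ ()) (λ ()))))

count : ∀ {m} {P : Fin m → Set} → (∀ x → Dec (P x)) → ℕ
count {zero} _ = 0
count {suc m} P? = (if does (P? F.zero) then 1 else 0) + count (P? ∘ F.suc)

count-mono : ∀ {m} {P Q : Fin m → Set} (P? : ∀ x → Dec (P x)) (Q? : ∀ x → Dec (Q x)) → (∀ x → P x → Q x) →
             count P? ≤ count Q?
count-mono {zero} _ _ _ = z≤n
count-mono {suc m} P? Q? P⇒Q with P? F.zero | Q? F.zero
... | yes _  | yes _  = s≤s (count-mono (P? ∘ F.suc) (Q? ∘ F.suc) (P⇒Q ∘ F.suc))
... | yes p₀ | no ¬q₀ = ⊥-elim (¬q₀ (P⇒Q F.zero p₀))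
... | no _   | yes _  = m≤n⇒m≤1+n (count-mono (P? ∘ F.suc) (Q? ∘ F.suc) (P⇒Q ∘ F.suc))
... | no _   | no _   = count-mono (P? ∘ F.suc) (Q? ∘ F.suc) (P⇒Q ∘ F.suc)

count-strict : ∀ {m} {P Q : Fin m → Set} (P? : ∀ x → Dec (P x)) (Q? : ∀ x → Dec (Q x)) → (∀ x → P x → Q x) →
               ∀ z → ¬ P z → Q z → count P? < count Q?
count-strict {suc m} P? Q? P⇒Q F.zero ¬p q with P? F.zero | Q? F.zero
... | yes p₀ | _     = ⊥-elim (¬p p₀)
... | no _   | no ¬q = ⊥-elim (¬q q)
... | no _   | yes _ = s≤s (count-mono (P? ∘ F.suc) (Q? ∘ F.suc) (P⇒Q ∘ F.suc))
count-strict {suc m} P? Q? P⇒Q (F.suc z) ¬p q with P? F.zero | Q? F.zero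
... | yes _  | yes _  = s≤s (count-strict (P? ∘ F.suc) (Q? ∘ F.suc) (P⇒Q ∘ F.suc) z ¬p q)
... | yes p₀ | no ¬q₀ = ⊥-elim (¬q₀ (P⇒Q F.zero p₀))
... | no _   | yes _  = m<n⇒m<1+n (count-strict (P? ∘ F.suc) (Q? ∘ F.suc) (P⇒Q ∘ F.suc) z ¬p q)
... | no _   | no _   = count-strict (P? ∘ F.suc) (Q? ∘ F.suc) (P⇒Q ∘ F.suc) z ¬p q

count-< : ∀ {m} {P : Fin m → Set} (P? : ∀ x → Dec (P x)) → ∀ z → ¬ P z → count P? < m
count-< {m} P? z ¬p = subst (count P? <_) (count-all m) (count-strict P? (λ _ → yes tt) (λ _ _ → tt) z ¬p tt)
  where
  count-all : ∀ m → count {m} (λ _ → yes tt) ≡ m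
  count-all zero = refl
  count-all (suc m) = cong suc (count-all m)

-- A missed value l would leave only m - 1 values for the injection of Fin m.
injective-inRange⇒surjective : ∀ {m} (h : Fin m → ℕ) → (∀ x y → h x ≡ h y → x ≡ y) → (∀ x → InRange m (h x)) →
                               ∀ l → 1 ≤ l → l ≤ m → ∃ λ x → h x ≡ l
injective-inRange⇒surjective {zero} h _ _ l l1 lm = ⊥-elim (<⇒≱ l1 lm)
injective-inRange⇒surjective {suc m} h h-inj h-range l l1 lm with FP.any? (λ x → h x ≟ l)
... | yes found = found
... | no missed = ⊥-elim (<-irrefl refl (FP.injective⇒≤ {f = g} g-inj))
  where
  index : ∀ {v} → InRange (suc m) v → Fin (suc m)
  index (v1 , vm) = fromℕ< (≤-trans (∸-monoʳ-< {_} {1} {0} (s≤s z≤n) v1) vm)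
  l≢ : ∀ x → index (l1 , lm) ≢ index (h-range x)
  l≢ x e = missed (x , ∸-cancelʳ-≡ (proj₁ (h-range x)) l1
                         (trans (sym (toℕ-fromℕ< _)) (trans (cong toℕ (sym e)) (toℕ-fromℕ< _))))
  g : Fin (suc m) → Fin m
  g x = F.punchOut (l≢ x)
  g-inj : ∀ {x y} → g x ≡ g y → x ≡ y
  g-inj {x} {y} e = h-inj x y (∸-cancelʳ-≡ (proj₁ (h-range x)) (proj₁ (h-range y))
    (trans (sym (toℕ-fromℕ< _)) (trans (cong toℕ (FP.punchOut-injective (l≢ x) (l≢ y) e)) (toℕ-fromℕ< _))))

-- Order by height (number of strict predecessors), then by index; label by counting predecessors.
module TopologicalSort {p : ℕ} (P : FinPoset p) where
  open FinPoset P
  module P = IsDecPartialOrder isDecPartialOrder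

  _≺_ : Fin p → Fin p → Set
  x ≺ y = x ≼ y × x ≢ y

  _≺?_ : ∀ x y → Dec (x ≺ y)
  x ≺? y = (x ≼? y) ×-dec ¬? (x FP.≟ y)

  height : Fin p → ℕ
  height x = count (_≺? x)

  height-mono : ∀ a b → a ≺ b → height a < height b
  height-mono a b (a≼b , a≢b) = count-strict (_≺? a) (_≺? b) below-a⇒below-b a (λ (_ , a≢a) → a≢a refl) (a≼b , a≢b)
    where
    below-a⇒below-b : ∀ y → y ≺ a → y ≺ b
    below-a⇒below-b y (y≼a , y≢a) = P.trans y≼a a≼b , λ { refl → a≢b (P.antisym a≼b y≼a) }

  _◁_ : Fin p → Fin p → Set
  x ◁ y = height x < height y ⊎ (height x ≡ height y × toℕ x < toℕ y)

  _◁?_ : ∀ x y → Dec (x ◁ y)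
  x ◁? y = (height x <? height y) ⊎-dec ((height x ≟ height y) ×-dec (toℕ x <? toℕ y))

  ◁-trans : ∀ {x y z} → x ◁ y → y ◁ z → x ◁ z
  ◁-trans (inj₁ a) (inj₁ b) = inj₁ (<-trans a b)
  ◁-trans (inj₁ a) (inj₂ (e , _)) = inj₁ (subst (_ <_) e a)
  ◁-trans (inj₂ (e , _)) (inj₁ b) = inj₁ (subst (_< _) (sym e) b)
  ◁-trans (inj₂ (e , a)) (inj₂ (e' , b)) = inj₂ (trans e e' , <-trans a b)

  ◁-irrefl : ∀ {x} → ¬ x ◁ x
  ◁-irrefl (inj₁ a) = <-irrefl refl a
  ◁-irrefl (inj₂ (_ , a)) = <-irrefl refl a

  ◁-connex : ∀ x y → x ≢ y → x ◁ y ⊎ y ◁ x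
  ◁-connex x y x≢y with <-cmp (height x) (height y)
  ... | tri< a _ _ = inj₁ (inj₁ a)
  ... | tri> _ _ c = inj₂ (inj₁ c)
  ... | tri≈ _ e _ with <-cmp (toℕ x) (toℕ y)
  ...   | tri< a _ _ = inj₁ (inj₂ (e , a))
  ...   | tri≈ _ e₂ _ = ⊥-elim (x≢y (toℕ-injective e₂))
  ...   | tri> _ _ c = inj₂ (inj₂ (sym e , c))

  label : Fin p → ℕ
  label x = suc (count (_◁? x))

  label-mono : ∀ x y → x ◁ y → label x < label y
  label-mono x y x◁y = s≤s (count-strict (_◁? x) (_◁? y) (λ z z◁x → ◁-trans z◁x x◁y) x ◁-irrefl x◁y)

  label-injective : ∀ x y → label x ≡ label y → x ≡ y
  label-injective x y e with x FP.≟ y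
  ... | yes x≡y = x≡y
  ... | no x≢y with ◁-connex x y x≢y
  ...   | inj₁ h = ⊥-elim (<-irrefl e (label-mono x y h))
  ...   | inj₂ h = ⊥-elim (<-irrefl (sym e) (label-mono y x h))

  label-inRange : ∀ x → InRange p (label x)
  label-inRange x = s≤s z≤n , count-< (_◁? x) x ◁-irrefl

  label-linExt : IsLinearExtension _≼_ label
  label-linExt = record
    { injective  = label-injective
    ; in-range   = label-inRange
    ; surjective = injective-inRange⇒surjective label label-injective label-inRange
    ; monotone   = λ a b a≼b a≢b → label-mono a b (inj₁ (height-mono a b (a≼b , a≢b))) }

chainsLE⇒toℕ≤ : ∀ λs x y → chainsLE λs x y → toℕ x ≤ toℕ y
chainsLE⇒toℕ≤ (m ∷ λs) x y h with splitAt m x in ex | splitAt m y in ey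
... | inj₁ u | inj₁ v = subst₂ _≤_ (trans (sym (toℕ-↑ˡ u _)) (cong toℕ (splitAt⁻¹-↑ˡ ex)))
                                   (trans (sym (toℕ-↑ˡ v _)) (cong toℕ (splitAt⁻¹-↑ˡ ey))) h
... | inj₂ u | inj₂ v = subst₂ _≤_ (trans (sym (toℕ-↑ʳ m u)) (cong toℕ (splitAt⁻¹-↑ʳ ex)))
                                   (trans (sym (toℕ-↑ʳ m v)) (cong toℕ (splitAt⁻¹-↑ʳ ey)))
                                   (+-monoʳ-≤ m (chainsLE⇒toℕ≤ λs u v h))

module BaseExtension {p q : ℕ} (P : FinPoset p) (λs : List ℕ) (Q : FinPoset q) where
  open OrdinalSum P λs Q
  module TP = TopologicalSort P
  module TQ = TopologicalSort Q

  base : Fin N → ℕ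
  base z with splitAt p z
  ... | inj₁ u = TP.label u
  ... | inj₂ w with splitAt n w
  ...   | inj₁ d = p + suc (toℕ d)
  ...   | inj₂ v = p + (n + TQ.label v)

  base-embP : ∀ u → base (embP u) ≡ TP.label u
  base-embP u rewrite splitAt-↑ˡ p u (n + q) = refl
  base-embD : ∀ d → base (embD d) ≡ p + suc (toℕ d)
  base-embD d rewrite splitAt-↑ʳ p (n + q) (d ↑ˡ q) | splitAt-↑ˡ n d q = refl
  base-embQ : ∀ v → base (embQ v) ≡ p + (n + TQ.label v)
  base-embQ v rewrite splitAt-↑ʳ p (n + q) (n ↑ʳ v) | splitAt-↑ʳ n q v = refl

  base-embP≤p : ∀ u → base (embP u) ≤ p
  base-embP≤p u = subst (_≤ p) (sym (base-embP u)) (proj₂ (TP.label-inRange u))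
  p<base-embD : ∀ d → p < base (embD d)
  p<base-embD d = subst (p <_) (sym (base-embD d)) (m<m+n p (s≤s z≤n))
  base-embD≤p+n : ∀ d → base (embD d) ≤ p + n
  base-embD≤p+n d = subst (_≤ p + n) (sym (base-embD d)) (+-monoʳ-≤ p (toℕ<n d))
  p+n<base-embQ : ∀ v → p + n < base (embQ v)
  p+n<base-embQ v = subst (p + n <_) (sym (base-embQ v))
                      (subst (_< p + (n + TQ.label v)) (cong (p +_) (+-identityʳ n))
                        (+-monoʳ-< p (+-monoʳ-< n (proj₁ (TQ.label-inRange v)))))

  embP<embD : ∀ u d → base (embP u) < base (embD d)
  embP<embD u d = ≤-<-trans (base-embP≤p u) (p<base-embD d)
  embD<embQ : ∀ d v → base (embD d) < base (embQ v)
  embD<embQ d v = ≤-<-trans (base-embD≤p+n d) (p+n<base-embQ v)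
  embP<embQ : ∀ u v → base (embP u) < base (embQ v)
  embP<embQ u v = ≤-<-trans (≤-trans (base-embP≤p u) (m≤m+n p n)) (p+n<base-embQ v)

  base-injective : ∀ x y → base x ≡ base y → x ≡ y
  base-injective x y e with part x | part y
  ... | fromP u refl | fromP u' refl = cong embP (TP.label-injective u u' (trans (sym (base-embP u)) (trans e (base-embP u'))))
  ... | fromD d refl | fromD d' refl =
    cong embD (toℕ-injective (suc-injective (+-cancelˡ-≡ p _ _ (trans (sym (base-embD d)) (trans e (base-embD d'))))))
  ... | fromQ v refl | fromQ v' refl =
    cong embQ (TQ.label-injective v v' (+-cancelˡ-≡ n _ _ (+-cancelˡ-≡ p _ _ (trans (sym (base-embQ v)) (trans e (base-embQ v'))))))
  ... | fromP u refl | fromD d refl = ⊥-elim (<-irrefl e (embP<embD u d))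
  ... | fromP u refl | fromQ v refl = ⊥-elim (<-irrefl e (embP<embQ u v))
  ... | fromD d refl | fromP u refl = ⊥-elim (<-irrefl (sym e) (embP<embD u d))
  ... | fromD d refl | fromQ v refl = ⊥-elim (<-irrefl e (embD<embQ d v))
  ... | fromQ v refl | fromP u refl = ⊥-elim (<-irrefl (sym e) (embP<embQ u v))
  ... | fromQ v refl | fromD d refl = ⊥-elim (<-irrefl (sym e) (embD<embQ d v))

  base-inRange : ∀ z → InRange N (base z)
  base-inRange z with part z
  ... | fromP u refl = subst (InRange N) (sym (base-embP u))
                         (proj₁ (TP.label-inRange u) , ≤-trans (proj₂ (TP.label-inRange u)) (m≤m+n p _))
  ... | fromD d refl = ≤-trans (s≤s z≤n) (p<base-embD d) ,
                       ≤-trans (base-embD≤p+n d) (subst (p + n ≤_) (+-assoc p n q) (m≤m+n (p + n) q))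
  ... | fromQ v refl = ≤-trans (s≤s z≤n) (p+n<base-embQ v) ,
                       subst (_≤ N) (sym (base-embQ v)) (+-monoʳ-≤ p (+-monoʳ-≤ n (proj₂ (TQ.label-inRange v))))

  base-monotone : ∀ a b → a ≼ b → a ≢ b → base a < base b
  base-monotone a b a≼b a≢b with part a | part b
  ... | fromP u refl | fromP u' refl =
    subst₂ _<_ (sym (base-embP u)) (sym (base-embP u'))
      (IsLinearExtension.monotone TP.label-linExt u u' (subst id (embP≼embP≡ u u') a≼b) (a≢b ∘ cong embP))
  ... | fromD d refl | fromD d' refl =
    subst₂ _<_ (sym (base-embD d)) (sym (base-embD d'))
      (+-monoʳ-< p (s≤s (≤∧≢⇒< (chainsLE⇒toℕ≤ λs d d' (subst id (embD≼embD≡chainsLE d d') a≼b))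
                                (a≢b ∘ cong embD ∘ toℕ-injective))))
  ... | fromQ v refl | fromQ v' refl =
    subst₂ _<_ (sym (base-embQ v)) (sym (base-embQ v'))
      (+-monoʳ-< p (+-monoʳ-< n
        (IsLinearExtension.monotone TQ.label-linExt v v' (subst id (embQ≼embQ≡ v v') a≼b) (a≢b ∘ cong embQ))))
  ... | fromP u refl | fromD d refl = embP<embD u d
  ... | fromP u refl | fromQ v refl = embP<embQ u v
  ... | fromD d refl | fromQ v refl = embD<embQ d v
  ... | fromD d refl | fromP u refl = ⊥-elim (embDQ⋠embP _ u a≼b)
  ... | fromQ v refl | fromP u refl = ⊥-elim (embDQ⋠embP _ u a≼b)
  ... | fromQ v refl | fromD d refl = ⊥-elim (embQ⋠embD v d a≼b)

  base-linExt : IsLinearExtension _≼_ base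
  base-linExt = record
    { injective  = base-injective
    ; in-range   = base-inRange
    ; surjective = injective-inRange⇒surjective base base-injective base-inRange
    ; monotone   = base-monotone }

index-bounds : ∀ {N i j k} → suc i < j → j < k → k ≤ N → suc i ≤ N × k ∸ 1 < N × k ∸ j < N
index-bounds {N} {i} {j} {k} i+1<j j<k k≤N = suc-i≤N , k∸1<N , ≤-<-trans (∸-monoʳ-≤ k j≥1) k∸1<N
  where
  j≥1 : 1 ≤ j
  j≥1 = ≤-trans (s≤s z≤n) i+1<j
  suc-i≤N : suc i ≤ N
  suc-i≤N = ≤-trans (≤-trans (n≤1+n _) i+1<j) (≤-trans (<⇒≤ j<k) k≤N)
  k∸1<N : k ∸ 1 < N
  k∸1<N = <-≤-trans (∸-monoʳ-< {k} {1} {0} (s≤s z≤n) (≤-trans j≥1 (<⇒≤ j<k))) k≤N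

-- n = suc n' with n' = a + sum (suc b ∷ rest), so the position algebra applies definitionally.
module Criterion {p q : ℕ} (P : FinPoset p) (Q : FinPoset q) (a b : ℕ) (rest : List ℕ)
             (n'≥3 : 3 ≤ a + sum (suc b ∷ rest)) (q+n≡p+4 : q + sum (suc a ∷ suc b ∷ rest) ≡ p + 4) where
  λs : List ℕ
  λs = suc a ∷ suc b ∷ rest
  open OrdinalSum P λs Q
  open Tracking P λs Q
  open SquareOnPositions p (a + sum (suc b ∷ rest)) n'≥3
    using (σsq-fixes; σup-1; σup-2; module Critical)

  sufficiency : ¬ (modRep q n ≡ 1 ⊎ modRep q n ≡ 3) → Property P λs Q
  sufficiency r∉ f le i j k i≥1 i+1<j j<k k≤N d =
    columnWord-determines (sq i j k f) f le-sq le tracks-id d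
    where
    bounds = index-bounds i+1<j j<k k≤N
    iN = proj₁ bounds
    k₁ = proj₁ (proj₂ bounds)
    kⱼ = proj₂ (proj₂ bounds)
    le-sq = sq-linExt i j k f le i≥1 iN k₁ kⱼ
    tracks-id : Tracks (f ∘ embD) (sq i j k f ∘ embD) id
    tracks-id =
      tracks-resp (λ _ → refl)
        (λ x l e → let (l1 , ln) = labelD-inRange (sq i j k f) le-sq x l e in
                   sym (σsq-fixes q i j k q+n≡p+4 (r∉ ∘ inj₁) (r∉ ∘ inj₂) i+1<j k≤N l l1 ln))
        (sq-tracks (f ∘ embD) i j k f le i≥1 iN k₁ kⱼ id (tracks-refl f le))

  -- Counterexample: t_{p+1} ⋯ t_{p+a+1} applied to the base extension yields the column word 1 0 …,
  -- and (t_{p+1} q_{p+3,N})² then carries one of its first two D-labels into the other column.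
  necessity : Property P λs Q → ¬ (modRep q n ≡ 1 ⊎ modRep q n ≡ 3)
  necessity property r∈ = 0≢1+n (by-residue r∈)
    where
    open BaseExtension P λs Q using (base; base-linExt; base-embD)
    n' = a + sum (suc b ∷ rest)

    a+1≤n' : suc a ≤ n'
    a+1≤n' = subst (_≤ n') (+-comm a 1) (+-monoʳ-≤ a (s≤s z≤n))
    2≤n : 2 ≤ n
    2≤n = s≤s (≤-trans (s≤s z≤n) n'≥3)
    p+a+1<N : p + suc a < N
    p+a+1<N = +-monoʳ-< p (≤-trans (s≤s a+1≤n') (m≤m+n n q))

    h₀ : Fin n → ℕ
    h₀ = base ∘ embD

    first second : Fin n
    first = F.zero
    second = suc a ↑ʳ F.zero

    h₀-first : h₀ first ≡ p + 1
    h₀-first = base-embD first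
    h₀-second : h₀ second ≡ p + suc (suc a)
    h₀-second = trans (base-embD second) (cong (λ v → p + suc v) (trans (toℕ-↑ʳ (suc a) F.zero) (+-identityʳ (suc a))))
    column-second : column λs second ≡ 1
    column-second rewrite splitAt-↑ʳ (suc a) (sum (suc b ∷ rest)) F.zero = refl

    f₁ : Fin N → ℕ
    f₁ = up (suc a) base
    le₁ : LinExt f₁
    le₁ = up-linExt (suc a) base base-linExt p+a+1<N
    tracks-up : Tracks h₀ (f₁ ∘ embD) (σup (suc a))
    tracks-up = up-tracks h₀ (suc a) base base-linExt p+a+1<N id (tracks-refl base base-linExt)

    i+1<j : suc (p + 1) < p + 3
    i+1<j = ≤-reflexive (sym (trans (+-suc p 2) (cong suc (+-suc p 1))))
    j<N : p + 3 < N
    j<N = +-monoʳ-< p (≤-trans (s≤s n'≥3) (m≤m+n n q))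
    bounds = index-bounds i+1<j j<N ≤-refl
    iN = proj₁ bounds
    k₁ = proj₁ (proj₂ bounds)
    kⱼ = proj₂ (proj₂ bounds)
    tracks-square : Tracks h₀ (f₁ ∘ embD) (σup (suc a) ∘ σsq (p + 1) (p + 3) N)
    tracks-square =
      tracks-resp (sym ∘ property f₁ le₁ (p + 1) (p + 3) N (m≤n+m 1 p) i+1<j j<N ≤-refl) (λ _ _ _ → refl)
        (sq-tracks h₀ (p + 1) (p + 3) N f₁ le₁ (m≤n+m 1 p) iN k₁ kⱼ (σup (suc a)) tracks-up)

    σup-1≡ : p + suc (suc a) ≡ p + σup (suc a) 1
    σup-1≡ = cong (p +_) (sym (σup-1 (suc a) a+1≤n'))
    σup-2≡ : p + 1 ≡ p + σup (suc a) 2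
    σup-2≡ = cong (p +_) (sym (σup-2 (suc a) (s≤s z≤n) a+1≤n'))

    by-residue : modRep q n ≡ 1 ⊎ modRep q n ≡ 3 → 0 ≡ 1
    by-residue (inj₁ r≡1) =
      let (x , f₁x) = labelD-surjective f₁ le₁ 2 (s≤s z≤n , 2≤n)
          moved = cong (λ v → p + σup (suc a) v) (Critical.σsq-critical-moves-2 q q+n≡p+4 r≡1)
      in trans (sym (tracks-up x first 2 f₁x (trans h₀-first σup-2≡)))
           (trans (tracks-square x second 2 f₁x (trans h₀-second (trans σup-1≡ (sym moved)))) column-second)
    by-residue (inj₂ r≡3) =
      let (x , f₁x) = labelD-surjective f₁ le₁ 1 (s≤s z≤n , s≤s z≤n)
          moved = cong (λ v → p + σup (suc a) v) (Critical.σsq-critical-moves-1 q q+n≡p+4 r≡3)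
      in trans (sym (tracks-square x first 1 f₁x (trans h₀-first (trans σup-2≡ (sym moved)))))
           (trans (tracks-up x second 1 f₁x (trans h₀-second σup-1≡)) column-second)

lemma4p10-for-parts : ∀ {p q} (P : FinPoset p) (Q : FinPoset q) (λs : List ℕ) → All (0 <_) λs → 1 < length λs →
                      3 < sum λs → p ≡ q + sum λs ∸ 4 →
                      Property P λs Q ⇔ (¬ (modRep q (sum λs) ≡ 1 ⊎ modRep q (sum λs) ≡ 3))
lemma4p10-for-parts P Q (_ ∷ []) _ (s≤s ()) _ _
lemma4p10-for-parts P Q (suc a ∷ suc b ∷ rest) (s≤s z≤n ∷ s≤s z≤n ∷ _) _ n>3 p≡ =
  mk⇔ necessity sufficiency
  where
  open Criterion P Q a b rest (≤-pred n>3) (sym (trans (cong (_+ 4) p≡) (m∸n+n≡m (≤-trans n>3 (m≤n+m _ _)))))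

lemma4p10 : (n p q : ℕ) (P : FinPoset p) (Q : FinPoset q) (λs : List ℕ) →
            IsPartitionD n λs → (n>3 : 3 < n) → p ≡ q + n ∸ 4 →
            Property P λs Q ⇔ (¬ (modRep q n ≡ 1 ⊎ modRep q n ≡ 3))
lemma4p10 n p q P Q λs isD =
  subst (λ m → 3 < m → p ≡ q + m ∸ 4 → Property P λs Q ⇔ (¬ (modRep q m ≡ 1 ⊎ modRep q m ≡ 3))) sums-to
    (lemma4p10-for-parts P Q λs parts-pos two-parts)
  where open IsPartitionD isD
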